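{- Let $R_1,R_2$ be $\le_{\mathcal{I}}$-incomparable ceers, each of which is either a dark minimal ceer or a $\mathbb{Z}$-dark minimal ceer, and suppose $x_0,y_0\in\omega$ are such that the classes $[x_0]_{R_1}$ and $[y_0]_{R_2}$ are non-computable. Let $x=2x_0$ and $y=2y_0+1$. Then $R_1\oplus R_2$ and $(R_1\oplus R_2)_{/(x,y)}$ are $\le_{\mathcal{I}}$-incomparable ceers.
   Context: A ceer is a computably enumerable equivalence relation on $\omega$. $R\le S$ means there is a total computable $f$ with $x\,R\,y\iff f(x)\,S\,f(y)$; $R\equiv S$ means $R\le S\le R$. $\mathrm{Id}$ is equality on $\omega$; for $n\ge1$, $\mathrm{Id}_n$ is congruence mod $n$, $R\oplus\mathrm{Id}_0:=R$; $R\oplus S$ is the uniform join: $2u\,(R\oplus S)\,2v$ iff $u\,R\,v$, $2u+1\,(R\oplus S)\,2v+1$ iff $u\,S\,v$, no even related to an odd. $E_{/(x,y)}$ is the equivalence relation generated by $E\cup\{(x,y)\}$. A ceer is finite if it has finitely many classes, light if $\mathrm{Id}\le R$, dark if neither. $R\le_{\mathcal{I}}S$ means $R\le S\oplus\mathrm{Id}_k$ for some $k\ge0$; $\equiv_{\mathcal{I}}$ is the induced equivalence. A dark minimal ceer is a dark ceer $D$ such that every ceer $X\le D$ is finite or $X\equiv D$. A dark ceer $R$ has minimal $\mathcal{I}$-degree if every ceer $X\le_{\mathcal{I}}R$ is finite or satisfies $R\le_{\mathcal{I}}X$. A $\mathbb{Z}$-dark minimal ceer is a dark ceer of minimal $\mathcal{I}$-degree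 which is not $\equiv_{\mathcal{I}}$ to any dark minimal ceer. -}

module Defs where

open import Data.Nat using (ℕ; zero; suc; _<_; _*_; _+_)
open import Data.Nat.DivMod using (_%_; _/_)
open import Data.Fin using (Fin)
open import Data.Vec using (Vec; []; _∷_; lookup)
open import Data.Product using (Σ; ∃; _×_; _,_)
open import Data.Sum using (_⊎_)
open import Data.Empty using (⊥)
open import Relation.Nullary using (¬_)
open import Relation.Binary.PropositionalEquality using (_≡_)
open import Relation.Binary.Structures using (IsEquivalence)
open import Function.Bundles using (_⇔_)

data PR : ℕ → Set where
  zer  : ∀ {n} → PR n
  succ : PR 1
  proj : ∀ {n} → Fin n → PR n
  comp : ∀ {n m} → PR m → Vec (PR n) m → PR n
  prec : ∀ {n} → PR n → PR (suc (suc n)) → PR (suc n)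
  mu   : ∀ {n} → PR (suc n) → PR n

data Eval : ∀ {n} → PR n → Vec ℕ n → ℕ → Set
data EvalVec : ∀ {n m} → Vec (PR n) m → Vec ℕ n → Vec ℕ m → Set

data Eval where
  ev-zer  : ∀ {n} {xs : Vec ℕ n} → Eval zer xs 0
  ev-succ : ∀ {x} → Eval succ (x ∷ []) (suc x)
  ev-proj : ∀ {n} {xs : Vec ℕ n} (i : Fin n) → Eval (proj i) xs (lookup xs i)
  ev-comp : ∀ {n m} {f : PR m} {gs : Vec (PR n) m} {xs ys z} →
            EvalVec gs xs ys → Eval f ys z → Eval (comp f gs) xs z
  ev-prec-z : ∀ {n} {g : PR n} {h} {xs z} →
              Eval g xs z → Eval (prec g h) (0 ∷ xs) z
  ev-prec-s : ∀ {n} {g : PR n} {h} {xs k r z} →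
              Eval (prec g h) (k ∷ xs) r → Eval h (k ∷ r ∷ xs) z →
              Eval (prec g h) (suc k ∷ xs) z
  ev-mu : ∀ {n} {f : PR (suc n)} {xs k} →
          Eval f (k ∷ xs) 0 →
          (∀ j → j < k → Σ ℕ (λ v → Eval f (j ∷ xs) (suc v))) →
          Eval (mu f) xs k

data EvalVec where
  []  : ∀ {n} {xs : Vec ℕ n} → EvalVec [] xs []
  _∷_ : ∀ {n m} {g : PR n} {gs : Vec (PR n) m} {xs y ys} →
        Eval g xs y → EvalVec gs xs ys → EvalVec (g ∷ gs) xs (y ∷ ys)

Computable : (ℕ → ℕ) → Set
Computable f = Σ (PR 1) λ c → ∀ x → Eval c (x ∷ []) (f x)

ComputableSet : (ℕ → Set) → Set
ComputableSet A = Σ (ℕ → ℕ) λ χ → Computable χ × (∀ x → A x ⇔ (χ x ≡ 0))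

Rel : Set₁
Rel = ℕ → ℕ → Set

CE : Rel → Set
CE R = Σ (PR 2) λ c → ∀ x y → R x y ⇔ ∃ (λ v → Eval c (x ∷ y ∷ []) v)

IsCeer : Rel → Set
IsCeer R = IsEquivalence R × CE R

_≤c_ : Rel → Rel → Set
R ≤c S = Σ (ℕ → ℕ) λ f → Computable f × (∀ x y → R x y ⇔ S (f x) (f y))

_≡c_ : Rel → Rel → Set
R ≡c S = (R ≤c S) × (S ≤c R)

IdRel : Rel
IdRel x y = x ≡ y

_⊕_ : Rel → Rel → Rel
(R ⊕ S) a b = (a % 2 ≡ 0 × b % 2 ≡ 0 × R (a / 2) (b / 2))
            ⊎ (a % 2 ≡ 1 × b % 2 ≡ 1 × S (a / 2) (b / 2))

-- R ⊕ Id_k, with the convention R ⊕ Id_0 := R and Id_n = congruence mod n (n ≥ 1)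
_⊕Id_ : Rel → ℕ → Rel
R ⊕Id zero  = R
R ⊕Id suc n = R ⊕ (λ x y → x % suc n ≡ y % suc n)

data Collapse (E : Rel) (x y : ℕ) : Rel where
  base  : ∀ {a b} → E a b → Collapse E x y a b
  pair  : Collapse E x y x y
  refl′ : ∀ {a} → Collapse E x y a a
  sym′  : ∀ {a b} → Collapse E x y a b → Collapse E x y b a
  trans′ : ∀ {a b c} → Collapse E x y a b → Collapse E x y b c → Collapse E x y a c

Finite : Rel → Set
Finite R = Σ ℕ λ n → Σ (Fin n → ℕ) λ a → ∀ z → ∃ λ i → R z (a i)

Light : Rel → Set
Light R = IdRel ≤c R

Dark : Rel → Set
Dark R = ¬ Finite R × ¬ Light R

_≤I_ : Rel → Rel → Set
R ≤I S = Σ ℕ λ k → R ≤c (S ⊕Id k)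

_≡I_ : Rel → Rel → Set
R ≡I S = (R ≤I S) × (S ≤I R)

IncomparableI : Rel → Rel → Set
IncomparableI R S = ¬ (R ≤I S) × ¬ (S ≤I R)

DarkMinimal : Rel → Set₁
DarkMinimal D = IsCeer D × Dark D ×
  (∀ (X : Rel) → IsCeer X → X ≤c D → Finite X ⊎ (X ≡c D))

MinimalIDegree : Rel → Set₁
MinimalIDegree R = ∀ (X : Rel) → IsCeer X → X ≤I R → Finite X ⊎ (R ≤I X)

ZDarkMinimal : Rel → Set₁
ZDarkMinimal R = IsCeer R × Dark R × MinimalIDegree R ×
  (∀ (D : Rel) → DarkMinimal D → ¬ (R ≡I D))

module Submission where

-- A reduction C ≤I S splits R₁ and R₂ and sends the C-equal points 2x₀ and
-- 2y₀+1 to different tags; a reduction S ≤I C splits R₁ or R₂ with the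
-- extra "no return" property.

open import Defs
open import Data.Nat using (ℕ; zero; suc; _+_; _*_; _∸_; _≤_; _<_; _⊔_; z≤n; s≤s)
open import Data.Nat.Properties
  using (+-comm; +-suc; +-identityʳ; *-comm; *-suc; <-cmp; <-irrefl; _≟_; m≤m⊔n; m≤n⊔m;
         m≤n⇒m<n∨m≡n; m≤n⇒m≤1+n; ≤-pred; ≤-refl; ≤-trans; ≤∧≢⇒<; <⇒≤)
open import Data.Nat.DivMod
  using (_%_; _/_; [m+kn]%n≡m%n; m*n%n≡0; m*n/n≡m; +-distrib-/-∣ʳ; m%n<n;
         m<n⇒m%n≡m; m≡m%n+[m/n]*n; n%n≡0)
open import Data.Nat.Divisibility using (n∣m*n)
open import Data.Fin using (Fin; zero; suc)
open import Data.Vec using (Vec; []; _∷_; lookup; tabulate)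
open import Data.Vec.Properties using (tabulate∘lookup)
open import Data.Product using (Σ; ∃; _×_; _,_; proj₁; proj₂)
open import Data.Sum using (_⊎_; inj₁; inj₂) renaming (map to ⊎-map)
open import Data.Empty using (⊥; ⊥-elim)
open import Relation.Nullary using (¬_; Dec; yes; no)
open import Relation.Binary.PropositionalEquality
  using (_≡_; _≢_; refl; sym; trans; cong; cong₂; subst; subst₂; module ≡-Reasoning)
open import Relation.Binary.Structures using (IsEquivalence)
open import Relation.Binary.Definitions using (tri<; tri≈; tri>)
open import Function.Base using (_∘_)
open import Function.Bundles using (Equivalence; _⇔_; mk⇔)
open import Function.Properties.Equivalence using () renaming (refl to ⇔-refl; sym to ⇔-sym; trans to ⇔-trans)
open Equivalence using (to; from)

0≢1 : 0 ≢ 1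
0≢1 ()

0≢2 : 0 ≢ 2
0≢2 ()

1≢2 : 1 ≢ 2
1≢2 ()

suc≢0 : ∀ {v} → suc v ≢ 0
suc≢0 ()

even%2 : ∀ m → 2 * m % 2 ≡ 0
even%2 m = trans (cong (_% 2) (*-comm 2 m)) (m*n%n≡0 m 2)

even/2 : ∀ m → 2 * m / 2 ≡ m
even/2 m = trans (cong (_/ 2) (*-comm 2 m)) (m*n/n≡m m 2)

-- 2m+1 written as 1 + m·2, the shape the DivMod lemmas expect
odd-shape : ∀ m → 2 * m + 1 ≡ 1 + m * 2
odd-shape m = trans (+-comm (2 * m) 1) (cong (1 +_) (*-comm 2 m))

odd%2 : ∀ m → (2 * m + 1) % 2 ≡ 1
odd%2 m = trans (cong (_% 2) (odd-shape m)) ([m+kn]%n≡m%n 1 m 2)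

odd/2 : ∀ m → (2 * m + 1) / 2 ≡ m
odd/2 m = trans (cong (_/ 2) (odd-shape m))
                (trans (+-distrib-/-∣ʳ 1 {d = 2} (n∣m*n m)) (m*n/n≡m m 2))

suc-even : ∀ m → suc (2 * m) ≡ 2 * m + 1
suc-even m = +-comm 1 (2 * m)

suc-odd : ∀ m → suc (2 * m + 1) ≡ 2 * suc m
suc-odd m = trans (cong suc (+-comm (2 * m) 1)) (sym (*-suc 2 m))

data Parity : ℕ → Set where
  even : ∀ m → Parity (2 * m)
  odd  : ∀ m → Parity (2 * m + 1)

parity : ∀ a → Parity a
parity zero = even 0
parity (suc a) with parity a
... | even m = subst Parity (sym (suc-even m)) (odd m)
... | odd m  = subst Parity (sym (suc-odd m)) (even (suc m))

%2≢2 : ∀ m → m % 2 ≢ 2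
%2≢2 m e = <-irrefl refl (subst (_< 2) e (m%n<n m 2))

-- halving in one step, the recursion used to compute x / 2
half-step : ∀ x → suc x / 2 ≡ x / 2 + x % 2
half-step x with parity x
... | even m = begin
  suc (2 * m) / 2        ≡⟨ cong (_/ 2) (suc-even m) ⟩
  (2 * m + 1) / 2        ≡⟨ odd/2 m ⟩
  m                      ≡⟨ sym (+-identityʳ m) ⟩
  m + 0                  ≡⟨ sym (cong₂ _+_ (even/2 m) (even%2 m)) ⟩
  2 * m / 2 + 2 * m % 2  ∎
  where open ≡-Reasoning
... | odd m = begin
  suc (2 * m + 1) / 2                ≡⟨ cong (_/ 2) (suc-odd m) ⟩
  2 * suc m / 2                      ≡⟨ even/2 (suc m) ⟩
  suc m                              ≡⟨ +-comm 1 m ⟩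
  m + 1                              ≡⟨ sym (cong₂ _+_ (odd/2 m) (odd%2 m)) ⟩
  (2 * m + 1) / 2 + (2 * m + 1) % 2  ∎
  where open ≡-Reasoning

ifz : ℕ → ℕ → ℕ → ℕ
ifz zero    b c = b
ifz (suc _) b c = c

neq : ℕ → ℕ → ℕ
neq zero    zero    = 0
neq zero    (suc y) = 1
neq (suc x) zero    = 1
neq (suc x) (suc y) = neq x y

neq-refl : ∀ x → neq x x ≡ 0
neq-refl zero    = refl
neq-refl (suc x) = neq-refl x

neq-sound : ∀ x y → neq x y ≡ 0 → x ≡ y
neq-sound zero    zero    e = refl
neq-sound (suc x) (suc y) e = cong suc (neq-sound x y e)
neq-sound zero    (suc y) ()
neq-sound (suc x) zero    ()

-- the residue mod d+1 in one step, the recursion used to compute x % (d+1)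
mod-step : ∀ x d → suc x % suc d ≡ ifz (neq (suc (x % suc d)) (suc d)) 0 (suc (x % suc d))
mod-step x d = begin
  suc x % suc d                                  ≡⟨ cong (λ z → suc z % suc d) (m≡m%n+[m/n]*n x (suc d)) ⟩
  (suc (x % suc d) + x / suc d * suc d) % suc d  ≡⟨ [m+kn]%n≡m%n (suc (x % suc d)) (x / suc d) (suc d) ⟩
  suc (x % suc d) % suc d                        ≡⟨ residue (x % suc d) (m%n<n x (suc d)) ⟩
  ifz (neq (suc (x % suc d)) (suc d)) 0 (suc (x % suc d)) ∎
  where
  open ≡-Reasoning
  residue : ∀ r → r < suc d → suc r % suc d ≡ ifz (neq (suc r) (suc d)) 0 (suc r)
  residue r r<1+d with neq (suc r) (suc d) in eq
  ... | zero rewrite neq-sound r d eq = n%n≡0 (suc d)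
  ... | suc _ = m<n⇒m%n≡m (≤∧≢⇒< r<1+d (λ { refl → suc≢0 (trans (sym eq) (neq-refl r)) }))

record Tot (n : ℕ) : Set where
  constructor mkTot
  field
    code : PR n
    fun  : Vec ℕ n → ℕ
    ok   : ∀ xs → Eval code xs (fun xs)
open Tot public

reshape : ∀ {n} (T : Tot n) (g : Vec ℕ n → ℕ) → (∀ xs → fun T xs ≡ g xs) → Tot n
reshape T g e = mkTot (code T) g (λ xs → subst (Eval (code T) xs) (e xs) (ok T xs))

zeroT : ∀ {n} → Tot n
zeroT = mkTot zer (λ _ → 0) (λ _ → ev-zer)

projT : ∀ {n} → Fin n → Tot n
projT i = mkTot (proj i) (λ xs → lookup xs i) (λ xs → ev-proj i)

sucT : Tot 1
sucT = mkTot succ (λ { (x ∷ []) → suc x }) (λ { (x ∷ []) → ev-succ })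

evalArgs : ∀ {n m} (Gs : Fin m → Tot n) xs →
  EvalVec (tabulate (λ i → code (Gs i))) xs (tabulate (λ i → fun (Gs i) xs))
evalArgs {m = zero}  Gs xs = []
evalArgs {m = suc m} Gs xs = ok (Gs zero) xs ∷ evalArgs (λ i → Gs (suc i)) xs

compT : ∀ {n m} → Tot m → (Fin m → Tot n) → Tot n
compT F Gs = mkTot (comp (code F) (tabulate (λ i → code (Gs i))))
                   (λ xs → fun F (tabulate (λ i → fun (Gs i) xs)))
                   (λ xs → ev-comp (evalArgs Gs xs) (ok F _))

iterate : ∀ {n} → Tot n → Tot (suc (suc n)) → ℕ → Vec ℕ n → ℕ
iterate G H zero    xs = fun G xs
iterate G H (suc k) xs = fun H (k ∷ iterate G H k xs ∷ xs)

iterate-ok : ∀ {n} (G : Tot n) (H : Tot (suc (suc n))) k xs →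
  Eval (prec (code G) (code H)) (k ∷ xs) (iterate G H k xs)
iterate-ok G H zero    xs = ev-prec-z (ok G xs)
iterate-ok G H (suc k) xs = ev-prec-s (iterate-ok G H k xs) (ok H _)

recT : ∀ {n} → Tot n → Tot (suc (suc n)) → Tot (suc n)
recT G H = mkTot (prec (code G) (code H)) (λ { (k ∷ xs) → iterate G H k xs })
                 (λ { (k ∷ xs) → iterate-ok G H k xs })

app₁ : ∀ {n} → Tot 1 → Tot n → Tot n
app₁ F A = compT F (λ { zero → A })

app₂ : ∀ {n} → Tot 2 → Tot n → Tot n → Tot n
app₂ F A B = compT F (λ { zero → A ; (suc zero) → B })

app₃ : ∀ {n} → Tot 3 → Tot n → Tot n → Tot n → Tot n
app₃ F A B C = compT F (λ { zero → A ; (suc zero) → B ; (suc (suc zero)) → C })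

#0 : ∀ {n} → Tot (suc n)
#0 = projT zero

#1 : ∀ {n} → Tot (suc (suc n))
#1 = projT (suc zero)

#2 : ∀ {n} → Tot (suc (suc (suc n)))
#2 = projT (suc (suc zero))

constT : ∀ {n} → ℕ → Tot n
constT c = reshape (numeral c) (λ _ → c) (value c)
  where
  numeral : ∀ {n} → ℕ → Tot n
  numeral zero    = zeroT
  numeral (suc c) = app₁ sucT (numeral c)
  value : ∀ {n} c (xs : Vec ℕ n) → fun (numeral c) xs ≡ c
  value zero    xs = refl
  value (suc c) xs = cong suc (value c xs)

addT : Tot 2
addT = reshape (recT #0 (app₁ sucT #1)) (λ { (x ∷ y ∷ []) → x + y }) (λ { (x ∷ y ∷ []) → sum x y })
  where
  sum : ∀ x y → iterate #0 (app₁ sucT #1) x (y ∷ []) ≡ x + y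
  sum zero    y = refl
  sum (suc x) y = cong suc (sum x y)

predT : Tot 1
predT = reshape (recT zeroT #0) (λ { (x ∷ []) → x ∸ 1 })
                (λ { (zero ∷ []) → refl ; (suc x ∷ []) → refl })

-- monusT (x , y) = y ∸ x, by recursion on x
monusT : Tot 2
monusT = reshape (recT #0 (app₁ predT #1)) (λ { (x ∷ y ∷ []) → y ∸ x }) (λ { (x ∷ y ∷ []) → monus x y })
  where
  pred-∸ : ∀ y x → (y ∸ x) ∸ 1 ≡ y ∸ suc x
  pred-∸ zero    zero    = refl
  pred-∸ zero    (suc x) = refl
  pred-∸ (suc y) zero    = refl
  pred-∸ (suc y) (suc x) = pred-∸ y x
  monus : ∀ x y → iterate #0 (app₁ predT #1) x (y ∷ []) ≡ y ∸ x
  monus zero    y = refl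
  monus (suc x) y = trans (cong (_∸ 1) (monus x y)) (pred-∸ y x)

ifzT : Tot 3
ifzT = reshape (recT #0 (projT (suc (suc (suc zero))))) (λ { (a ∷ b ∷ c ∷ []) → ifz a b c })
               (λ { (zero ∷ b ∷ c ∷ []) → refl ; (suc a ∷ b ∷ c ∷ []) → refl })

_+T_ : ∀ {n} → Tot n → Tot n → Tot n
A +T B = app₂ addT A B

_∸T_ : ∀ {n} → Tot n → Tot n → Tot n
A ∸T B = app₂ monusT B A

ifZero : ∀ {n} → Tot n → Tot n → Tot n → Tot n
ifZero A B C = app₃ ifzT A B C

neqT : Tot 2
neqT = reshape (ifZero ((#0 ∸T #1) +T (#1 ∸T #0)) zeroT (constT 1))
               (λ { (x ∷ y ∷ []) → neq x y }) (λ { (x ∷ y ∷ []) → agree x y })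
  where
  agree : ∀ x y → ifz ((x ∸ y) + (y ∸ x)) 0 1 ≡ neq x y
  agree zero    zero    = refl
  agree zero    (suc y) = refl
  agree (suc x) zero    = refl
  agree (suc x) (suc y) = agree x y

modT : ℕ → Tot 1
modT d = reshape (recT zeroT step) (λ { (x ∷ []) → x % suc d }) (λ { (x ∷ []) → residue x })
  where
  step : Tot 2
  step = ifZero (app₂ neqT (app₁ sucT #1) (constT (suc d))) zeroT (app₁ sucT #1)
  residue : ∀ x → iterate zeroT step x [] ≡ x % suc d
  residue zero = refl
  residue (suc x) rewrite residue x = sym (mod-step x d)

mod2T : Tot 1
mod2T = modT 1

div2T : Tot 1
div2T = reshape (recT zeroT (#1 +T app₁ mod2T #0)) (λ { (x ∷ []) → x / 2 }) (λ { (x ∷ []) → half x })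
  where
  half : ∀ x → iterate zeroT (#1 +T app₁ mod2T #0) x [] ≡ x / 2
  half zero    = refl
  half (suc x) = trans (cong (_+ x % 2) (half x)) (sym (half-step x))

doubleT : Tot 1
doubleT = reshape (#0 +T #0) (λ { (x ∷ []) → 2 * x }) (λ { (x ∷ []) → cong (x +_) (sym (+-identityʳ x)) })

eval-det : ∀ {n} {c : PR n} {xs z z'} → Eval c xs z → Eval c xs z' → z ≡ z'
evalVec-det : ∀ {n m} {gs : Vec (PR n) m} {xs ys ys'} → EvalVec gs xs ys → EvalVec gs xs ys' → ys ≡ ys'
eval-det ev-zer ev-zer = refl
eval-det ev-succ ev-succ = refl
eval-det (ev-proj i) (ev-proj .i) = refl
eval-det (ev-comp v e) (ev-comp v' e') with evalVec-det v v'
... | refl = eval-det e e'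
eval-det (ev-prec-z e) (ev-prec-z e') = eval-det e e'
eval-det (ev-prec-s r e) (ev-prec-s r' e') with eval-det r r'
... | refl = eval-det e e'
eval-det (ev-mu {k = k} e below) (ev-mu {k = k'} e' below') with <-cmp k k'
... | tri≈ _ k≡k' _ = k≡k'
... | tri< k<k' _ _ with eval-det e (proj₂ (below' k k<k'))
... | ()
eval-det (ev-mu e below) (ev-mu e' below') | tri> _ _ k'<k with eval-det e' (proj₂ (below _ k'<k))
... | ()
evalVec-det [] [] = refl
evalVec-det (e ∷ v) (e' ∷ v') = cong₂ _∷_ (eval-det e e') (evalVec-det v v')

comp-total : ∀ {n m} (c : PR m) (Gs : Fin m → Tot n) xs v →
  Eval (comp c (tabulate (λ i → code (Gs i)))) xs v ⇔ Eval c (tabulate (λ i → fun (Gs i) xs)) v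
comp-total c Gs xs v = mk⇔ head (ev-comp (evalArgs Gs xs))
  where
  head : Eval (comp c (tabulate (λ i → code (Gs i)))) xs v → Eval c (tabulate (λ i → fun (Gs i) xs)) v
  head (ev-comp args e) with evalVec-det args (evalArgs Gs xs)
  ... | refl = e

-- The step-counting interpreter.  run s c xs is 0 if c has not yet
-- converged with fuel s, and suc v if it converged with value v.  The
-- fuel bounds the length of μ-searches only.

run : ∀ {n} → ℕ → PR n → Vec ℕ n → ℕ
runAll : ∀ {n m} → ℕ → Vec (PR n) m → Vec ℕ n → ℕ
runArgs : ∀ {n m} → ℕ → Vec (PR n) m → Vec ℕ n → Vec ℕ m
runRec : ∀ {n} → ℕ → PR n → PR (suc (suc n)) → ℕ → Vec ℕ n → ℕ
searchState : ∀ {n} → ℕ → PR (suc n) → Vec ℕ n → ℕ → ℕ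

-- one step of a μ-search in state 1 ("candidates so far were positive"):
-- candidate i gave code c; 0 = stuck, suc (suc i) = found i
searchStep : ℕ → ℕ → ℕ
searchStep c i = ifz c 0 (ifz (c ∸ 1) (suc (suc i)) 1)

run s zer xs = 1
run s succ (x ∷ []) = suc (suc x)
run s (proj i) xs = suc (lookup xs i)
run s (comp f gs) xs = ifz (runAll s gs xs) 0 (run s f (runArgs s gs xs))
run s (prec g h) (k ∷ xs) = runRec s g h k xs
run s (mu f) xs = searchState s f xs s ∸ 1

runAll s [] xs = 1
runAll s (g ∷ gs) xs = ifz (run s g xs) 0 (runAll s gs xs)
runArgs s [] xs = []
runArgs s (g ∷ gs) xs = (run s g xs ∸ 1) ∷ runArgs s gs xs

runRec s g h zero xs = run s g xs
runRec s g h (suc k) xs = ifz (runRec s g h k xs) 0 (run s h (k ∷ (runRec s g h k xs ∸ 1) ∷ xs))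

-- state after examining candidates 0 … i-1: 1 = still searching
searchState s f xs zero = 1
searchState s f xs (suc i) =
  ifz (neq (searchState s f xs i) 1) (searchStep (run s f (i ∷ xs)) i) (searchState s f xs i)

module Search {n} (s : ℕ) (f : PR (suc n)) (xs : Vec ℕ n) where
  private
    r : ℕ → ℕ
    r j = run s f (j ∷ xs)

    Positive : ℕ → Set
    Positive j = ∃ λ w → r j ≡ suc (suc w)

    step-searching : ∀ m c i → ifz (neq m 1) (searchStep c i) m ≡ 1 → (m ≡ 1) × ∃ λ w → c ≡ suc (suc w)
    step-searching zero c i ()
    step-searching (suc zero) zero i ()
    step-searching (suc zero) (suc zero) i ()
    step-searching (suc zero) (suc (suc w)) i e = refl , w , refl
    step-searching (suc (suc m)) c i ()

    step-found : ∀ m c i v → ifz (neq m 1) (searchStep c i) m ≡ suc (suc v) →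
      (m ≡ suc (suc v)) ⊎ ((m ≡ 1) × (v ≡ i) × (c ≡ 1))
    step-found zero c i v ()
    step-found (suc zero) zero i v ()
    step-found (suc zero) (suc zero) i .i refl = inj₂ (refl , refl , refl)
    step-found (suc zero) (suc (suc w)) i v ()
    step-found (suc (suc m)) c i v e = inj₁ e

  searching⇒positive : ∀ i → searchState s f xs i ≡ 1 → ∀ j → j < i → Positive j
  searching⇒positive zero e j ()
  searching⇒positive (suc i) e j j<1+i with step-searching (searchState s f xs i) (r i) i e
  ... | e₁ , w , e₂ with m≤n⇒m<n∨m≡n (≤-pred j<1+i)
  ... | inj₁ j<i = searching⇒positive i e₁ j j<i
  ... | inj₂ refl = w , e₂

  found⇒least : ∀ i v → searchState s f xs i ≡ suc (suc v) →
    (r v ≡ 1) × (∀ j → j < v → Positive j) × v < i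
  found⇒least zero v ()
  found⇒least (suc i) v e with step-found (searchState s f xs i) (r i) i v e
  ... | inj₁ e₁ = let (zero-at , below , v<i) = found⇒least i v e₁ in zero-at , below , m≤n⇒m≤1+n v<i
  ... | inj₂ (e₁ , refl , e₃) = e₃ , searching⇒positive i e₁ , ≤-refl

  positive⇒searching : ∀ i → (∀ j → j < i → Positive j) → searchState s f xs i ≡ 1
  positive⇒searching zero below = refl
  positive⇒searching (suc i) below
    with positive⇒searching i (λ j j<i → below j (m≤n⇒m≤1+n j<i)) | below i ≤-refl
  ... | e₁ | w , e₂ rewrite e₁ | e₂ = refl

  least⇒found : ∀ v i → v < i → r v ≡ 1 → (∀ j → j < v → Positive j) →
    searchState s f xs i ≡ suc (suc v)
  least⇒found v (suc i) (s≤s v≤i) zero-at below with m≤n⇒m<n∨m≡n v≤i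
  ... | inj₂ refl rewrite positive⇒searching v below | zero-at = refl
  ... | inj₁ v<i rewrite least⇒found v i v<i zero-at below = refl

run-sound : ∀ {n} s (c : PR n) xs v → run s c xs ≡ suc v → Eval c xs v
runAll-sound : ∀ {n m} s (gs : Vec (PR n) m) xs a → runAll s gs xs ≡ suc a → EvalVec gs xs (runArgs s gs xs)
runRec-sound : ∀ {n} s (g : PR n) h k xs v → runRec s g h k xs ≡ suc v → Eval (prec g h) (k ∷ xs) v

run-sound s zer xs .0 refl = ev-zer
run-sound s succ (x ∷ []) .(suc x) refl = ev-succ
run-sound s (proj i) xs .(lookup xs i) refl = ev-proj i
run-sound s (comp f gs) xs v e with runAll s gs xs in eq
... | suc a = ev-comp (runAll-sound s gs xs a eq) (run-sound s f _ v e)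
run-sound s (prec g h) (k ∷ xs) v e = runRec-sound s g h k xs v e
run-sound s (mu f) xs v e with searchState s f xs s in eq
... | suc (suc v') with e
... | refl = let (zero-at , below , _) = Search.found⇒least s f xs s v eq in
  ev-mu (run-sound s f _ 0 zero-at) (λ j j<v → let (w , q) = below j j<v in w , run-sound s f _ (suc w) q)

runAll-sound s [] xs a e = []
runAll-sound s (g ∷ gs) xs a e with run s g xs in eq
... | suc w = run-sound s g xs w eq ∷ runAll-sound s gs xs a e

runRec-sound s g h zero xs v e = ev-prec-z (run-sound s g xs v e)
runRec-sound s g h (suc k) xs v e with runRec s g h k xs in eq
... | suc r = ev-prec-s (runRec-sound s g h k xs r eq) (run-sound s h _ v e)

run-mono : ∀ {n} s s' → s ≤ s' → (c : PR n) → ∀ xs v → run s c xs ≡ suc v → run s' c xs ≡ suc v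
runAll-mono : ∀ {n m} s s' → s ≤ s' → (gs : Vec (PR n) m) → ∀ xs a → runAll s gs xs ≡ suc a →
  (runAll s' gs xs ≡ suc a) × (runArgs s' gs xs ≡ runArgs s gs xs)
runRec-mono : ∀ {n} s s' → s ≤ s' → ∀ (g : PR n) h k xs v →
  runRec s g h k xs ≡ suc v → runRec s' g h k xs ≡ suc v

run-mono s s' le zer xs v e = e
run-mono s s' le succ (x ∷ []) v e = e
run-mono s s' le (proj i) xs v e = e
run-mono s s' le (comp f gs) xs v e with runAll s gs xs in eq
... | suc a with runAll-mono s s' le gs xs a eq
... | e₁ , e₂ rewrite e₁ | e₂ = run-mono s s' le f _ v e
run-mono s s' le (prec g h) (k ∷ xs) v e = runRec-mono s s' le g h k xs v e
run-mono s s' le (mu f) xs v e with searchState s f xs s in eq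
... | suc (suc v') with e
... | refl = let (zero-at , below , v<s) = Search.found⇒least s f xs s v eq in
  cong (_∸ 1) (Search.least⇒found s' f xs v s' (≤-trans v<s le) (run-mono s s' le f _ 0 zero-at)
     (λ j j<v → let (w , q) = below j j<v in w , run-mono s s' le f _ (suc w) q))

runAll-mono s s' le [] xs a e = e , refl
runAll-mono s s' le (g ∷ gs) xs a e with run s g xs in eq
... | suc w rewrite run-mono s s' le g xs w eq with runAll-mono s s' le gs xs a e
... | e₁ , e₂ = e₁ , cong (w ∷_) e₂

runRec-mono s s' le g h zero xs v e = run-mono s s' le g xs v e
runRec-mono s s' le g h (suc k) xs v e with runRec s g h k xs in eq
... | suc r rewrite runRec-mono s s' le g h k xs r eq = run-mono s s' le h _ v e

run-monoˡ : ∀ {n} s s' (c : PR n) xs v → run s c xs ≡ suc v → run (s ⊔ s') c xs ≡ suc v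
run-monoˡ s s' = run-mono s (s ⊔ s') (m≤m⊔n s s')

run-monoʳ : ∀ {n} s s' (c : PR n) xs v → run s' c xs ≡ suc v → run (s ⊔ s') c xs ≡ suc v
run-monoʳ s s' = run-mono s' (s ⊔ s') (m≤n⊔m s s')

common-fuel : ∀ {n} (f : PR (suc n)) xs k →
  (∀ j → j < k → ∃ λ s → ∃ λ w → run s f (j ∷ xs) ≡ suc (suc w)) →
  ∃ λ S → ∀ j → j < k → ∃ λ w → run S f (j ∷ xs) ≡ suc (suc w)
common-fuel f xs zero h = 0 , λ j ()
common-fuel f xs (suc k) h with common-fuel f xs k (λ j j<k → h j (m≤n⇒m≤1+n j<k)) | h k ≤-refl
... | S₁ , h₁ | s₂ , w₂ , e₂ = S₁ ⊔ s₂ , below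
  where
  below : ∀ j → j < suc k → ∃ λ w → run (S₁ ⊔ s₂) f (j ∷ xs) ≡ suc (suc w)
  below j j<1+k with m≤n⇒m<n∨m≡n (≤-pred j<1+k)
  ... | inj₁ j<k = let (w , e) = h₁ j j<k in w , run-monoˡ S₁ s₂ f _ (suc w) e
  ... | inj₂ refl = w₂ , run-monoʳ S₁ s₂ f _ (suc w₂) e₂

run-complete : ∀ {n} {c : PR n} {xs v} → Eval c xs v → ∃ λ s → run s c xs ≡ suc v
runAll-complete : ∀ {n m} {gs : Vec (PR n) m} {xs ys} → EvalVec gs xs ys →
  ∃ λ s → (runAll s gs xs ≡ 1) × (runArgs s gs xs ≡ ys)

run-complete ev-zer = 0 , refl
run-complete ev-succ = 0 , refl
run-complete (ev-proj i) = 0 , refl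
run-complete {c = comp f gs} {xs} {v} (ev-comp {ys = ys} args e) with runAll-complete args | run-complete e
... | s₁ , a₁ , b₁ | s₂ , e₂ with runAll-mono s₁ (s₁ ⊔ s₂) (m≤m⊔n s₁ s₂) gs xs 0 a₁
... | a , b = s₁ ⊔ s₂ ,
  trans (cong₂ (λ A B → ifz A 0 (run (s₁ ⊔ s₂) f B)) a (trans b b₁)) (run-monoʳ s₁ s₂ f ys v e₂)
run-complete (ev-prec-z e) = run-complete e
run-complete {c = prec g h} {suc k ∷ xs} {v} (ev-prec-s {r = r} er e) with run-complete er | run-complete e
... | s₁ , e₁ | s₂ , e₂ = s₁ ⊔ s₂ ,
  trans (cong (λ A → ifz A 0 (run (s₁ ⊔ s₂) h (k ∷ (A ∸ 1) ∷ xs))) (run-monoˡ s₁ s₂ (prec g h) (k ∷ xs) r e₁))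
        (run-monoʳ s₁ s₂ h _ v e₂)
run-complete {c = mu f} {xs} {k} (ev-mu e below)
  with run-complete e
     | common-fuel f xs k (λ j j<k → let (w , ej) = below j j<k ; (s , r) = run-complete ej in s , w , r)
... | s₀ , e₀ | S , hS = T , cong (_∸ 1) (Search.least⇒found T f xs k T (m≤n⊔m (s₀ ⊔ S) (suc k))
      (run-mono s₀ T (≤-trans (m≤m⊔n s₀ S) T-big) f _ 0 e₀)
      (λ j j<k → let (w , q) = hS j j<k in w , run-mono S T (≤-trans (m≤n⊔m s₀ S) T-big) f _ (suc w) q))
  where
  T : ℕ
  T = (s₀ ⊔ S) ⊔ suc k
  T-big : s₀ ⊔ S ≤ T
  T-big = m≤m⊔n (s₀ ⊔ S) (suc k)

runAll-complete [] = 0 , refl , refl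
runAll-complete {gs = g ∷ gs} {xs} (_∷_ {y = y} e args) with run-complete e | runAll-complete args
... | s₁ , e₁ | s₂ , a₂ , b₂ with runAll-mono s₂ (s₁ ⊔ s₂) (m≤n⊔m s₁ s₂) gs xs 0 a₂
... | a , b = s₁ ⊔ s₂ , cong₂ (λ A B → ifz A 0 B) (run-monoˡ s₁ s₂ g xs y e₁) a ,
                        cong₂ (λ A B → (A ∸ 1) ∷ B) (run-monoˡ s₁ s₂ g xs y e₁) (trans b b₂)

-- The interpreter is itself computable: for every program c there is a
-- total program computing (s , xs) ↦ run s c xs.

Clocked : ∀ {n} → PR n → Set
Clocked {n} c = Σ (Tot (suc n)) λ T → ∀ s xs → fun T (s ∷ xs) ≡ run s c xs

record ClockedVec {n m} (gs : Vec (PR n) m) : Set where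
  field
    allT : Tot (suc n)
    allE : ∀ s xs → fun allT (s ∷ xs) ≡ runAll s gs xs
    argT : Fin m → Tot (suc n)
    argE : ∀ s xs → tabulate (λ i → fun (argT i) (s ∷ xs)) ≡ runArgs s gs xs

clocked-comp : ∀ {n m} (f : PR m) (gs : Vec (PR n) m) → Clocked f → ClockedVec gs → Clocked (comp f gs)
clocked-comp {n} {m} f gs (F , eF) V = ifZero allT zeroT (compT F args) , λ s xs →
  cong₂ (λ A B → ifz A 0 B) (allE s xs) (trans (cong (λ v → fun F (s ∷ v)) (argE s xs)) (eF s _))
  where
  open ClockedVec V
  args : Fin (suc m) → Tot (suc n)
  args zero    = #0
  args (suc i) = argT i

clocked-prec : ∀ {n} (g : PR n) h → Clocked g → Clocked h → Clocked (prec g h)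
clocked-prec {n} g h (G , eG) (Hc , eH) =
  compT (recT G H) fuelLast ,
  λ s → λ { (k ∷ xs) → trans (cong (λ v → iterate G H k (s ∷ v)) (tabulate∘lookup xs)) (agree s k xs) }
  where
  -- arguments of h, read from (k , acc , s , xs), with acc = run … ∸ 1 decoded
  hArgs : Fin (suc (suc (suc n))) → Tot (suc (suc (suc n)))
  hArgs zero = #2
  hArgs (suc zero) = #0
  hArgs (suc (suc zero)) = app₁ predT #1
  hArgs (suc (suc (suc i))) = projT (suc (suc (suc i)))
  H : Tot (suc (suc (suc n)))
  H = ifZero #1 zeroT (compT Hc hArgs)
  -- recursion runs on the first argument, so move the fuel behind it
  fuelLast : Fin (suc (suc n)) → Tot (suc (suc n))
  fuelLast zero = #1
  fuelLast (suc zero) = #0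
  fuelLast (suc (suc i)) = projT (suc (suc i))
  agree : ∀ s k xs → iterate G H k (s ∷ xs) ≡ runRec s g h k xs
  agree s zero xs = eG s xs
  agree s (suc k) xs = cong₂ (λ A B → ifz A 0 B) (agree s k xs)
     (trans (cong (λ v → fun Hc (s ∷ k ∷ (iterate G H k (s ∷ xs) ∸ 1) ∷ v)) (tabulate∘lookup xs))
       (trans (eH s _) (cong (λ A → run s h (k ∷ (A ∸ 1) ∷ xs)) (agree s k xs))))

clocked-mu : ∀ {n} (f : PR (suc n)) → Clocked f → Clocked (mu f)
clocked-mu {n} f (F , eF) =
  (compT M fuelTwice ∸T constT 1) ,
  λ s xs → cong (_∸ 1) (trans (cong (λ v → iterate (constT 1) Step s (s ∷ v)) (tabulate∘lookup xs))
                              (agree s s xs))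
  where
  -- run s f (i , xs), read from (i , state , s , xs)
  fArgs : Fin (suc (suc n)) → Tot (suc (suc (suc n)))
  fArgs zero = #2
  fArgs (suc zero) = #0
  fArgs (suc (suc j)) = projT (suc (suc (suc j)))
  Cand : Tot (suc (suc (suc n)))
  Cand = compT F fArgs
  Step : Tot (suc (suc (suc n)))
  Step = ifZero (app₂ neqT #1 (constT 1))
                (ifZero Cand zeroT (ifZero (Cand ∸T constT 1) (app₁ sucT (app₁ sucT #0)) (constT 1)))
                #1
  M : Tot (suc (suc n))
  M = recT (constT 1) Step
  -- the search runs for s steps with fuel s
  fuelTwice : Fin (suc (suc n)) → Tot (suc n)
  fuelTwice zero = #0
  fuelTwice (suc zero) = #0
  fuelTwice (suc (suc j)) = projT (suc j)
  cand : ∀ s i xs m → fun Cand (i ∷ m ∷ s ∷ xs) ≡ run s f (i ∷ xs)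
  cand s i xs m = trans (cong (λ v → fun F (s ∷ i ∷ v)) (tabulate∘lookup xs)) (eF s _)
  agree : ∀ s i xs → iterate (constT 1) Step i (s ∷ xs) ≡ searchState s f xs i
  agree s zero xs = refl
  agree s (suc i) xs rewrite cand s i xs (iterate (constT 1) Step i (s ∷ xs)) | agree s i xs = refl

clocked : ∀ {n} (c : PR n) → Clocked c
clockedVec : ∀ {n m} (gs : Vec (PR n) m) → ClockedVec gs

clocked zer = constT 1 , λ s xs → refl
clocked succ = app₁ sucT (app₁ sucT #1) , λ { s (x ∷ []) → refl }
clocked (proj i) = app₁ sucT (projT (suc i)) , λ s xs → refl
clocked (comp f gs) = clocked-comp f gs (clocked f) (clockedVec gs)
clocked {suc n} (prec g h) = clocked-prec g h (clocked g) (clocked h)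
clocked (mu f) = clocked-mu f (clocked f)

clockedVec [] = record { allT = constT 1 ; allE = λ s xs → refl ; argT = λ () ; argE = λ s xs → refl }
clockedVec (g ∷ gs) with clocked g | clockedVec gs
... | G , eG | V = record
  { allT = ifZero G zeroT (ClockedVec.allT V)
  ; allE = λ s xs → cong₂ (λ A B → ifz A 0 B) (eG s xs) (ClockedVec.allE V s xs)
  ; argT = λ { zero → app₁ predT G ; (suc i) → ClockedVec.argT V i }
  ; argE = λ s xs → cong₂ (λ A B → (A ∸ 1) ∷ B) (eG s xs) (ClockedVec.argE V s xs) }

clock : ∀ {n} (c : PR n) → Tot (suc n)
clock c = reshape (proj₁ (clocked c)) (λ { (s ∷ xs) → run s c xs }) (λ { (s ∷ xs) → proj₂ (clocked c) s xs })

firstZero : (ℕ → ℕ) → ℕ → ℕ → ℕ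
firstZero P zero    j = j
firstZero P (suc r) j = ifz (P j) j (firstZero P r (suc j))

firstZero-spec : ∀ P r j → P (r + j) ≡ 0 →
  (P (firstZero P r j) ≡ 0) × (∀ i → j ≤ i → i < firstZero P r j → P i ≢ 0)
firstZero-spec P zero j e = e , λ i j≤i i<j → ⊥-elim (<-irrefl refl (≤-trans i<j j≤i))
firstZero-spec P (suc r) j e with P j in eq
... | zero = eq , λ i j≤i i<j → ⊥-elim (<-irrefl refl (≤-trans i<j j≤i))
... | suc v with firstZero-spec P r (suc j) (subst (λ z → P z ≡ 0) (sym (+-suc r j)) e)
... | root , positive = root , skip
  where
  skip : ∀ i → j ≤ i → i < firstZero P r (suc j) → P i ≢ 0
  skip i j≤i i<fz with m≤n⇒m<n∨m≡n j≤i
  ... | inj₁ j<i = positive i j<i i<fz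
  ... | inj₂ refl = λ z → suc≢0 (trans (sym eq) z)

module _ {n} (F : Tot (suc n)) (xs : Vec ℕ n) (k : ℕ) (root : fun F (k ∷ xs) ≡ 0) where
  private
    P : ℕ → ℕ
    P j = fun F (j ∷ xs)
    spec : (P (firstZero P k 0) ≡ 0) × (∀ i → 0 ≤ i → i < firstZero P k 0 → P i ≢ 0)
    spec = firstZero-spec P k 0 (subst (λ z → P z ≡ 0) (sym (+-identityʳ k)) root)

  leastRoot : ℕ
  leastRoot = firstZero P k 0

  leastRoot-root : fun F (leastRoot ∷ xs) ≡ 0
  leastRoot-root = proj₁ spec

  mu-eval : Eval (mu (code F)) xs leastRoot
  mu-eval = ev-mu (subst (Eval (code F) _) leastRoot-root (ok F _)) (λ j j<m → positive j (proj₂ spec j z≤n j<m))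
    where
    positive : ∀ j → P j ≢ 0 → Σ ℕ λ v → Eval (code F) (j ∷ xs) (suc v)
    positive j nz with P j in eq
    ... | zero = ⊥-elim (nz refl)
    ... | suc v = v , subst (Eval (code F) _) eq (ok F _)

minimise : ∀ {n} (F : Tot (suc n)) → (∀ xs → ∃ λ k → fun F (k ∷ xs) ≡ 0) → Tot n
minimise F roots = mkTot (mu (code F)) (λ xs → leastRoot F xs _ (proj₂ (roots xs)))
                                       (λ xs → mu-eval F xs _ (proj₂ (roots xs)))

minimise-root : ∀ {n} (F : Tot (suc n)) roots xs → fun F (fun (minimise F roots) xs ∷ xs) ≡ 0
minimise-root F roots xs = leastRoot-root F xs _ (proj₂ (roots xs))

Halts : ∀ {n} → PR n → Vec ℕ n → Set
Halts c xs = ∃ λ v → Eval c xs v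

SemiDec : ∀ {n} → (Vec ℕ n → Set) → Set
SemiDec {n} P = Σ (PR n) λ c → ∀ xs → P xs ⇔ Halts c xs

mu-halts : ∀ {n} (F : Tot (suc n)) xs → Halts (mu (code F)) xs ⇔ ∃ λ k → fun F (k ∷ xs) ≡ 0
mu-halts F xs = mk⇔ (λ { (k , ev-mu e _) → k , eval-det (ok F _) e })
                    (λ { (k , root) → _ , mu-eval F xs k root })

semi-⇔ : ∀ {n} {P Q : Vec ℕ n → Set} → (∀ xs → P xs ⇔ Q xs) → SemiDec P → SemiDec Q
semi-⇔ PQ (c , hc) = c , λ xs → ⇔-trans (⇔-sym (PQ xs)) (hc xs)

-- the zero set of a total function (search in a dummy variable)
semi-zero : ∀ {n} (F : Tot n) → SemiDec (λ xs → fun F xs ≡ 0)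
semi-zero {n} F = mu (code G) , λ xs →
  ⇔-sym (⇔-trans (mu-halts G xs) (mk⇔ (λ { (k , e) → trans (sym (ignore {k} xs)) e })
                                      (λ e → 0 , trans (ignore {0} xs) e)))
  where
  G : Tot (suc n)
  G = compT F (λ i → projT (suc i))
  ignore : ∀ {k} xs → fun G (k ∷ xs) ≡ fun F xs
  ignore xs = cong (fun F) (tabulate∘lookup xs)

semi-≡ : ∀ {n} (A B : Tot n) → SemiDec (λ xs → fun A xs ≡ fun B xs)
semi-≡ A B = semi-⇔ equal (semi-zero (app₂ neqT A B))
  where
  equal : ∀ xs → (neq (fun A xs) (fun B xs) ≡ 0) ⇔ (fun A xs ≡ fun B xs)
  equal xs = mk⇔ (neq-sound _ _) (λ e → trans (cong (λ z → neq z (fun B xs)) e) (neq-refl (fun B xs)))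

semi-⊥ : ∀ {n} → SemiDec {n} (λ _ → ⊥)
semi-⊥ = semi-⇔ (λ xs → mk⇔ (λ ()) (λ ())) (semi-zero (constT 1))

semi-× : ∀ {n} {P Q : Vec ℕ n → Set} → SemiDec P → SemiDec Q → SemiDec (λ xs → P xs × Q xs)
semi-× (c , hc) (d , hd) = comp zer (c ∷ d ∷ []) , λ xs → mk⇔
  (λ { (p , q) → let (_ , ec) = to (hc xs) p ; (_ , ed) = to (hd xs) q in 0 , ev-comp (ec ∷ ed ∷ []) ev-zer })
  (λ { (_ , ev-comp (ec ∷ ed ∷ []) _) → from (hc xs) (_ , ec) , from (hd xs) (_ , ed) })

dovetail : ∀ {n} → PR n → PR n → Tot (suc n)
dovetail c d = ifZero (clock c) (ifZero (clock d) (constT 1) zeroT) zeroT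

Converged : ∀ {n} → ℕ → PR n → Vec ℕ n → Set
Converged s c xs = ∃ λ v → run s c xs ≡ suc v

dovetail-zero : ∀ {n} (c d : PR n) s xs →
  fun (dovetail c d) (s ∷ xs) ≡ 0 ⇔ (Converged s c xs ⊎ Converged s d xs)
dovetail-zero c d s xs = either (run s c xs) (run s d xs)
  where
  either : ∀ a b → ifz a (ifz b 1 0) 0 ≡ 0 ⇔ ((∃ λ v → a ≡ suc v) ⊎ (∃ λ v → b ≡ suc v))
  either zero zero = mk⇔ (λ ()) (λ { (inj₁ (_ , ())) ; (inj₂ (_ , ())) })
  either zero (suc b) = mk⇔ (λ _ → inj₂ (b , refl)) (λ _ → refl)
  either (suc a) b = mk⇔ (λ _ → inj₁ (a , refl)) (λ _ → refl)

halts⇔converged : ∀ {n} (c : PR n) xs → Halts c xs ⇔ ∃ λ s → Converged s c xs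
halts⇔converged c xs = mk⇔ (λ { (v , e) → let (s , r) = run-complete e in s , v , r })
                           (λ { (s , v , r) → v , run-sound s c xs v r })

dovetail-root : ∀ {n} (c d : PR n) xs →
  (∃ λ s → fun (dovetail c d) (s ∷ xs) ≡ 0) ⇔ (Halts c xs ⊎ Halts d xs)
dovetail-root c d xs = mk⇔
  (λ { (s , z) → ⊎-map (λ cv → from (halts⇔converged c xs) (s , cv))
                       (λ dv → from (halts⇔converged d xs) (s , dv))
                       (to (dovetail-zero c d s xs) z) })
  (λ { (inj₁ h) → let (s , cv) = to (halts⇔converged c xs) h in s , from (dovetail-zero c d s xs) (inj₁ cv)
     ; (inj₂ h) → let (s , dv) = to (halts⇔converged d xs) h in s , from (dovetail-zero c d s xs) (inj₂ dv) })

semi-⊎ : ∀ {n} {P Q : Vec ℕ n → Set} → SemiDec P → SemiDec Q → SemiDec (λ xs → P xs ⊎ Q xs)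
semi-⊎ (c , hc) (d , hd) = mu (code (dovetail c d)) , λ xs →
  ⇔-sym (⇔-trans (mu-halts (dovetail c d) xs)
        (⇔-trans (dovetail-root c d xs)
                 (mk⇔ (⊎-map (from (hc xs)) (from (hd xs))) (⊎-map (to (hc xs)) (to (hd xs))))))

semi-∃Fin : ∀ {n} m (P : Fin m → Vec ℕ n → Set) → (∀ i → SemiDec (P i)) →
  SemiDec (λ xs → Σ (Fin m) λ i → P i xs)
semi-∃Fin zero P sd = semi-⇔ (λ xs → mk⇔ (λ ()) (λ { (() , _) })) semi-⊥
semi-∃Fin (suc m) P sd =
  semi-⇔ (λ xs → mk⇔ split join) (semi-⊎ (sd zero) (semi-∃Fin m (λ i → P (suc i)) (λ i → sd (suc i))))
  where
  split : ∀ {xs} → P zero xs ⊎ (Σ (Fin m) λ i → P (suc i) xs) → Σ (Fin (suc m)) λ i → P i xs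
  split (inj₁ p) = zero , p
  split (inj₂ (i , p)) = suc i , p
  join : ∀ {xs} → (Σ (Fin (suc m)) λ i → P i xs) → P zero xs ⊎ (Σ (Fin m) λ i → P (suc i) xs)
  join (zero , p) = inj₁ p
  join (suc i , p) = inj₂ (i , p)

semi-rel : ∀ {n} {R : Rel} → CE R → (A B : Tot n) → SemiDec (λ xs → R (fun A xs) (fun B xs))
semi-rel (c , hc) A B = comp c (tabulate (λ i → code (args i))) ,
  λ xs → ⇔-trans (hc _ _) (mk⇔ (λ { (v , e) → v , from (comp-total c args xs v) e })
                                (λ { (v , e) → v , to (comp-total c args xs v) e }))
  where
  args : Fin 2 → Tot _
  args zero = A
  args (suc zero) = B

semi→CE : ∀ {R : Rel} {P : Vec ℕ 2 → Set} → SemiDec P → (∀ x y → R x y ⇔ P (x ∷ y ∷ [])) → CE R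
semi→CE (c , hc) RP = c , λ x y → ⇔-trans (RP x y) (hc _)

-- Post's theorem: a predicate that is semi-decidable together with its
-- complement is decidable by a total program.

post : ∀ {n} {P Q : Vec ℕ n → Set} → SemiDec P → SemiDec Q →
  (∀ xs → P xs ⊎ Q xs) → (∀ xs → P xs → Q xs → ⊥) →
  Σ (Tot n) λ χ → ∀ xs → P xs ⇔ (fun χ xs ≡ 0)
post {n} {P} {Q} (c , hc) (d , hd) cover disjoint = χ , decides
  where
  roots : ∀ xs → ∃ λ s → fun (dovetail c d) (s ∷ xs) ≡ 0
  roots xs = from (dovetail-root c d xs) (⊎-map (to (hc xs)) (to (hd xs)) (cover xs))
  -- enough fuel for c or d to converge on xs
  fuel : Tot n
  fuel = minimise (dovetail c d) roots
  fuelArgs : Fin (suc n) → Tot n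
  fuelArgs zero = fuel
  fuelArgs (suc i) = projT i
  χ : Tot n
  χ = ifZero (compT (clock c) fuelArgs) (constT 1) zeroT
  χ-run : ∀ xs → fun χ xs ≡ ifz (run (fun fuel xs) c xs) 1 0
  χ-run xs = cong (λ v → ifz (run (fun fuel xs) c v) 1 0) (tabulate∘lookup xs)
  decides : ∀ xs → P xs ⇔ (fun χ xs ≡ 0)
  decides xs rewrite χ-run xs with run (fun fuel xs) c xs in eq
  ... | suc v = mk⇔ (λ _ → refl) (λ _ → from (hc xs) (v , run-sound _ c xs v eq))
  ... | zero with to (dovetail-zero c d _ xs) (minimise-root (dovetail c d) roots xs)
  ...   | inj₁ (_ , e) = ⊥-elim (suc≢0 (trans (sym e) eq))
  ...   | inj₂ (v , e) = mk⇔ (λ p → ⊥-elim (disjoint xs p (from (hd xs) (v , run-sound _ d xs v e)))) (λ ())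

toTot : ∀ {f} → Computable f → Tot 1
toTot {f} (c , p) = mkTot c (λ { (x ∷ []) → f x }) (λ { (x ∷ []) → p x })

tot-computable : (T : Tot 1) → Computable (λ x → fun T (x ∷ []))
tot-computable T = code T , λ x → ok T (x ∷ [])

computable-∘ : ∀ {f g} → Computable f → Computable g → Computable (λ x → g (f x))
computable-∘ F G = tot-computable (app₁ (toTot G) (toTot F))

decidedSet : ∀ {A : ℕ → Set} (χ : Tot 1) → (∀ z → A z ⇔ (fun χ (z ∷ []) ≡ 0)) → ComputableSet A
decidedSet χ decides = (λ z → fun χ (z ∷ [])) , tot-computable χ , decides

guarded : (Π A : Tot 1) (t : ℕ) →
  Σ (Tot 1) λ χ → ∀ z → ((fun Π (z ∷ []) ≡ t) × (fun A (z ∷ []) ≡ 0)) ⇔ (fun χ (z ∷ []) ≡ 0)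
guarded Π A t = ifZero (app₂ neqT Π (constT t)) A (constT 1) , λ z → test (fun Π (z ∷ [])) (fun A (z ∷ []))
  where
  test : ∀ p a → ((p ≡ t) × (a ≡ 0)) ⇔ (ifz (neq p t) a 1 ≡ 0)
  test p a with neq p t in eq
  ... | zero = mk⇔ proj₂ (λ a≡0 → neq-sound p t eq , a≡0)
  ... | suc _ = mk⇔ (λ { (refl , _) → ⊥-elim (suc≢0 (trans (sym eq) (neq-refl p))) }) (λ ())

pullback-isCeer : ∀ {R : Rel} → IsCeer R → (G : Tot 1) → IsCeer (λ a b → R (fun G (a ∷ [])) (fun G (b ∷ [])))
pullback-isCeer (eqv , ce) G =
  record { refl = IsEquivalence.refl eqv ; sym = IsEquivalence.sym eqv ; trans = IsEquivalence.trans eqv } ,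
  semi→CE (semi-rel ce (app₁ G #0) (app₁ G #1)) (λ x y → ⇔-refl)

module _ {R S : Rel} where
  ⊕-even : ∀ m n → (R ⊕ S) (2 * m) (2 * n) ⇔ R m n
  ⊕-even m n = mk⇔ left (λ r → inj₁ (even%2 m , even%2 n , subst₂ R (sym (even/2 m)) (sym (even/2 n)) r))
    where
    left : (R ⊕ S) (2 * m) (2 * n) → R m n
    left (inj₁ (_ , _ , r)) = subst₂ R (even/2 m) (even/2 n) r
    left (inj₂ (p , _ , _)) = ⊥-elim (0≢1 (trans (sym (even%2 m)) p))

  ⊕-odd : ∀ m n → (R ⊕ S) (2 * m + 1) (2 * n + 1) ⇔ S m n
  ⊕-odd m n = mk⇔ right (λ r → inj₂ (odd%2 m , odd%2 n , subst₂ S (sym (odd/2 m)) (sym (odd/2 n)) r))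
    where
    right : (R ⊕ S) (2 * m + 1) (2 * n + 1) → S m n
    right (inj₂ (_ , _ , r)) = subst₂ S (odd/2 m) (odd/2 n) r
    right (inj₁ (p , _ , _)) = ⊥-elim (0≢1 (trans (sym p) (odd%2 m)))

  ⊕-even-odd : ∀ m n → ¬ (R ⊕ S) (2 * m) (2 * n + 1)
  ⊕-even-odd m n (inj₁ (_ , p , _)) = 0≢1 (trans (sym p) (odd%2 n))
  ⊕-even-odd m n (inj₂ (p , _ , _)) = 0≢1 (trans (sym (even%2 m)) p)

  ⊕-odd-even : ∀ m n → ¬ (R ⊕ S) (2 * m + 1) (2 * n)
  ⊕-odd-even m n (inj₁ (p , _ , _)) = 0≢1 (trans (sym p) (odd%2 m))
  ⊕-odd-even m n (inj₂ (_ , p , _)) = 0≢1 (trans (sym (even%2 n)) p)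

  ⊕-to-even : ∀ a m → (R ⊕ S) a (2 * m) ⇔ (a % 2 ≡ 0 × R (a / 2) m)
  ⊕-to-even a m = mk⇔ left (λ { (p , r) → inj₁ (p , even%2 m , subst (R (a / 2)) (sym (even/2 m)) r) })
    where
    left : (R ⊕ S) a (2 * m) → a % 2 ≡ 0 × R (a / 2) m
    left (inj₁ (p , _ , r)) = p , subst (R (a / 2)) (even/2 m) r
    left (inj₂ (_ , q , _)) = ⊥-elim (0≢1 (trans (sym (even%2 m)) q))

  ⊕-to-odd : ∀ a m → (R ⊕ S) a (2 * m + 1) ⇔ (a % 2 ≡ 1 × S (a / 2) m)
  ⊕-to-odd a m = mk⇔ right (λ { (p , r) → inj₂ (p , odd%2 m , subst (S (a / 2)) (sym (odd/2 m)) r) })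
    where
    right : (R ⊕ S) a (2 * m + 1) → a % 2 ≡ 1 × S (a / 2) m
    right (inj₂ (p , _ , r)) = p , subst (S (a / 2)) (odd/2 m) r
    right (inj₁ (_ , q , _)) = ⊥-elim (0≢1 (trans (sym q) (odd%2 m)))

  ⊕-from-even : ∀ m b → (R ⊕ S) (2 * m) b ⇔ (b % 2 ≡ 0 × R m (b / 2))
  ⊕-from-even m b = mk⇔ left (λ { (p , r) → inj₁ (even%2 m , p , subst (λ z → R z (b / 2)) (sym (even/2 m)) r) })
    where
    left : (R ⊕ S) (2 * m) b → b % 2 ≡ 0 × R m (b / 2)
    left (inj₁ (_ , p , r)) = p , subst (λ z → R z (b / 2)) (even/2 m) r
    left (inj₂ (q , _ , _)) = ⊥-elim (0≢1 (trans (sym (even%2 m)) q))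

  ⊕-from-odd : ∀ m b → (R ⊕ S) (2 * m + 1) b ⇔ (b % 2 ≡ 1 × S m (b / 2))
  ⊕-from-odd m b = mk⇔ right (λ { (p , r) → inj₂ (odd%2 m , p , subst (λ z → S z (b / 2)) (sym (odd/2 m)) r) })
    where
    right : (R ⊕ S) (2 * m + 1) b → b % 2 ≡ 1 × S m (b / 2)
    right (inj₂ (_ , p , r)) = p , subst (λ z → S z (b / 2)) (odd/2 m) r
    right (inj₁ (q , _ , _)) = ⊥-elim (0≢1 (trans (sym q) (odd%2 m)))

≤c-trans : ∀ {R S U} → R ≤c S → S ≤c U → R ≤c U
≤c-trans (f , cf , hf) (g , cg , hg) = (λ x → g (f x)) , computable-∘ cf cg ,
  λ x y → ⇔-trans (hf x y) (hg _ _)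

⊕Id-mono : ∀ {X Y} k → X ≤c Y → (X ⊕Id k) ≤c (Y ⊕Id k)
⊕Id-mono zero r = r
⊕Id-mono {X} {Y} (suc k) (h , ch , hh) = h' , tot-computable H' , λ a b → on (parity a) (parity b)
  where
  M : Rel
  M x y = x % suc k ≡ y % suc k
  h' : ℕ → ℕ
  h' a = ifz (a % 2) (2 * h (a / 2)) a
  H' : Tot 1
  H' = ifZero (app₁ mod2T #0) (app₁ doubleT (app₁ (toTot ch) (app₁ div2T #0))) #0
  on-even : ∀ m → h' (2 * m) ≡ 2 * h m
  on-even m rewrite even%2 m | even/2 m = refl
  on-odd : ∀ m → h' (2 * m + 1) ≡ 2 * m + 1
  on-odd m rewrite odd%2 m = refl
  on : ∀ {a b} → Parity a → Parity b → (X ⊕ M) a b ⇔ (Y ⊕ M) (h' a) (h' b)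
  on (even m) (even n) rewrite on-even m | on-even n =
    ⇔-trans (⊕-even {X} {M} m n) (⇔-trans (hh m n) (⇔-sym (⊕-even {Y} {M} (h m) (h n))))
  on (even m) (odd n) rewrite on-even m | on-odd n =
    mk⇔ (⊥-elim ∘ ⊕-even-odd {X} {M} m n) (⊥-elim ∘ ⊕-even-odd {Y} {M} (h m) n)
  on (odd m) (even n) rewrite on-odd m | on-even n =
    mk⇔ (⊥-elim ∘ ⊕-odd-even {X} {M} m n) (⊥-elim ∘ ⊕-odd-even {Y} {M} m (h n))
  on (odd m) (odd n) rewrite on-odd m | on-odd n = ⇔-trans (⊕-odd {X} {M} m n) (⇔-sym (⊕-odd {Y} {M} m n))

≤I-≤c-trans : ∀ {R X R'} → R ≤I X → X ≤c R' → R ≤I R'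
≤I-≤c-trans {R} {X} {R'} (k , r) x = k , ≤c-trans {R} {X ⊕Id k} {R' ⊕Id k} r (⊕Id-mono {X} {R'} k x)

join-isEquivalence : ∀ {R₁ R₂ : Rel} → IsEquivalence R₁ → IsEquivalence R₂ → IsEquivalence (R₁ ⊕ R₂)
join-isEquivalence {R₁} {R₂} e₁ e₂ = record { refl = λ {a} → reflexive (parity a)
                                                          ; sym = λ {a} {b} → symmetric {a} {b}
                                                          ; trans = λ {a} {b} {c} → transitive {a} {b} {c} }
  where
  module E₁ = IsEquivalence e₁
  module E₂ = IsEquivalence e₂
  reflexive : ∀ {a} → Parity a → (R₁ ⊕ R₂) a a
  reflexive (even m) = from (⊕-even {R₁} {R₂} m m) E₁.refl
  reflexive (odd m) = from (⊕-odd {R₁} {R₂} m m) E₂.refl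
  symmetric : ∀ {a b} → (R₁ ⊕ R₂) a b → (R₁ ⊕ R₂) b a
  symmetric (inj₁ (p , q , r)) = inj₁ (q , p , E₁.sym r)
  symmetric (inj₂ (p , q , r)) = inj₂ (q , p , E₂.sym r)
  transitive : ∀ {a b c} → (R₁ ⊕ R₂) a b → (R₁ ⊕ R₂) b c → (R₁ ⊕ R₂) a c
  transitive (inj₁ (p , _ , r)) (inj₁ (_ , q , r')) = inj₁ (p , q , E₁.trans r r')
  transitive (inj₂ (p , _ , r)) (inj₂ (_ , q , r')) = inj₂ (p , q , E₂.trans r r')
  transitive (inj₁ (_ , q , _)) (inj₂ (p , _ , _)) = ⊥-elim (0≢1 (trans (sym q) p))
  transitive (inj₂ (_ , q , _)) (inj₁ (p , _ , _)) = ⊥-elim (0≢1 (trans (sym p) q))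

-- R₁ ⊕ R₂ is literally a Boolean combination of equations and instances of R₁, R₂
join-isCeer : ∀ {R₁ R₂ : Rel} → IsCeer R₁ → IsCeer R₂ → IsCeer (R₁ ⊕ R₂)
join-isCeer (e₁ , ce₁) (e₂ , ce₂) =
  join-isEquivalence e₁ e₂ ,
  semi→CE (semi-⊎ (semi-× (parityIs 0 #0) (semi-× (parityIs 0 #1) (half ce₁)))
                  (semi-× (parityIs 1 #0) (semi-× (parityIs 1 #1) (half ce₂))))
          (λ x y → ⇔-refl)
  where
  parityIs : ∀ t (A : Tot 2) → SemiDec (λ xs → fun (app₁ mod2T A) xs ≡ fun (constT t) xs)
  parityIs t A = semi-≡ (app₁ mod2T A) (constT t)
  half : ∀ {R} → CE R → SemiDec (λ xs → R (fun (app₁ div2T #0) xs) (fun (app₁ div2T #1) xs))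
  half ce = semi-rel ce (app₁ div2T #0) (app₁ div2T #1)

module CollapseNormalForm {E : Rel} (eqv : IsEquivalence E) (x y : ℕ) where
  open IsEquivalence eqv renaming (refl to E-refl; sym to E-sym; trans to E-trans)

  NF : Rel
  NF a b = E a b ⊎ (E a x × E y b) ⊎ (E a y × E x b)

  nf-sym : ∀ {a b} → NF a b → NF b a
  nf-sym (inj₁ ab) = inj₁ (E-sym ab)
  nf-sym (inj₂ (inj₁ (ax , yb))) = inj₂ (inj₂ (E-sym yb , E-sym ax))
  nf-sym (inj₂ (inj₂ (ay , xb))) = inj₂ (inj₁ (E-sym xb , E-sym ay))

  nf-trans : ∀ {a b c} → NF a b → NF b c → NF a c
  nf-trans (inj₁ ab) (inj₁ bc) = inj₁ (E-trans ab bc)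
  nf-trans (inj₁ ab) (inj₂ (inj₁ (bx , yc))) = inj₂ (inj₁ (E-trans ab bx , yc))
  nf-trans (inj₁ ab) (inj₂ (inj₂ (by , xc))) = inj₂ (inj₂ (E-trans ab by , xc))
  nf-trans (inj₂ (inj₁ (ax , yb))) (inj₁ bc) = inj₂ (inj₁ (ax , E-trans yb bc))
  nf-trans (inj₂ (inj₁ (ax , _))) (inj₂ (inj₁ (_ , yc))) = inj₂ (inj₁ (ax , yc))
  nf-trans (inj₂ (inj₁ (ax , _))) (inj₂ (inj₂ (_ , xc))) = inj₁ (E-trans ax xc)
  nf-trans (inj₂ (inj₂ (ay , xb))) (inj₁ bc) = inj₂ (inj₂ (ay , E-trans xb bc))
  nf-trans (inj₂ (inj₂ (ay , _))) (inj₂ (inj₁ (_ , yc))) = inj₁ (E-trans ay yc)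
  nf-trans (inj₂ (inj₂ (ay , _))) (inj₂ (inj₂ (_ , xc))) = inj₂ (inj₂ (ay , xc))

  collapse⇔NF : ∀ a b → Collapse E x y a b ⇔ NF a b
  collapse⇔NF a b = mk⇔ toNF fromNF
    where
    toNF : ∀ {a b} → Collapse E x y a b → NF a b
    toNF (base ab) = inj₁ ab
    toNF pair = inj₂ (inj₁ (E-refl , E-refl))
    toNF refl′ = inj₁ E-refl
    toNF (sym′ ba) = nf-sym (toNF ba)
    toNF (trans′ ab bc) = nf-trans (toNF ab) (toNF bc)
    fromNF : ∀ {a b} → NF a b → Collapse E x y a b
    fromNF (inj₁ ab) = base ab
    fromNF (inj₂ (inj₁ (ax , yb))) = trans′ (base ax) (trans′ pair (base yb))
    fromNF (inj₂ (inj₂ (ay , xb))) = trans′ (base ay) (trans′ (sym′ pair) (base xb))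

-- collapsing a ceer gives a ceer, since the normal form is c.e.
collapse-isCeer : ∀ {E : Rel} → IsCeer E → ∀ x y → IsCeer (Collapse E x y)
collapse-isCeer (eqv , ce) x y =
  record { refl = refl′ ; sym = sym′ ; trans = trans′ } ,
  semi→CE (semi-⊎ (semi-rel ce #0 #1)
                  (semi-⊎ (semi-× (semi-rel ce #0 (constT x)) (semi-rel ce (constT y) #1))
                          (semi-× (semi-rel ce #0 (constT y)) (semi-rel ce (constT x) #1))))
          collapse⇔NF
  where open CollapseNormalForm eqv x y

-- Tagged descriptions.  A point of W ⊕ Id_k, W a join, is read as a tag
-- (0 or 1 for the two halves of W, 2 for the Id_k part) and a datum.

Tagged : Set₁
Tagged = ℕ → ℕ → ℕ → ℕ → Set

Split : Rel → Rel → Tagged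
Split R R' p d p' d' = (p ≡ 0 × p' ≡ 0 × R d d')
                     ⊎ (p ≡ 1 × p' ≡ 1 × R' d d')
                     ⊎ (p ≡ 2 × p' ≡ 2 × d ≡ d')

TagTwoIsId : Tagged → Set
TagTwoIsId Φ = (∀ d d' → Φ 2 d 2 d' ⇔ (d ≡ d'))
              × (∀ p d d' → Φ p d 2 d' → p ≡ 2)
              × (∀ p d d' → Φ 2 d p d' → p ≡ 2)

split-tagTwoIsId : ∀ R R' → TagTwoIsId (Split R R')
split-tagTwoIsId R R' = two-is-id , two-right , two-left
  where
  two-is-id : ∀ d d' → Split R R' 2 d 2 d' ⇔ (d ≡ d')
  two-is-id d d' = mk⇔ (λ { (inj₁ (() , _)) ; (inj₂ (inj₁ (() , _))) ; (inj₂ (inj₂ (_ , _ , e))) → e })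
                       (λ e → inj₂ (inj₂ (refl , refl , e)))
  two-right : ∀ p d d' → Split R R' p d 2 d' → p ≡ 2
  two-right p d d' (inj₁ (_ , () , _))
  two-right p d d' (inj₂ (inj₁ (_ , () , _)))
  two-right p d d' (inj₂ (inj₂ (e , _))) = e
  two-left : ∀ p d d' → Split R R' 2 d p d' → p ≡ 2
  two-left p d d' (inj₁ (() , _))
  two-left p d d' (inj₂ (inj₁ (() , _)))
  two-left p d d' (inj₂ (inj₂ (_ , e , _))) = e

swapTag : ℕ → ℕ
swapTag zero = 1
swapTag (suc zero) = 0
swapTag (suc (suc p)) = suc (suc p)

swapTag-0 : ∀ p → swapTag p ≡ 0 → p ≡ 1
swapTag-0 zero ()
swapTag-0 (suc zero) _ = refl
swapTag-0 (suc (suc p)) ()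

swapTag-1 : ∀ p → swapTag p ≡ 1 → p ≡ 0
swapTag-1 zero _ = refl
swapTag-1 (suc zero) ()
swapTag-1 (suc (suc p)) ()

swapTag-2 : ∀ p → swapTag p ≡ 2 → p ≡ 2
swapTag-2 zero ()
swapTag-2 (suc zero) ()
swapTag-2 (suc (suc p)) e = e

split-swap : ∀ R R' p d p' d' → Split R R' p d p' d' ⇔ Split R' R (swapTag p) d (swapTag p') d'
split-swap R R' p d p' d' = mk⇔ there back
  where
  there : Split R R' p d p' d' → Split R' R (swapTag p) d (swapTag p') d'
  there (inj₁ (refl , refl , r)) = inj₂ (inj₁ (refl , refl , r))
  there (inj₂ (inj₁ (refl , refl , r))) = inj₁ (refl , refl , r)
  there (inj₂ (inj₂ (refl , refl , e))) = inj₂ (inj₂ (refl , refl , e))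
  back : Split R' R (swapTag p) d (swapTag p') d' → Split R R' p d p' d'
  back (inj₁ (a , b , r)) = inj₂ (inj₁ (swapTag-0 p a , swapTag-0 p' b , r))
  back (inj₂ (inj₁ (a , b , r))) = inj₁ (swapTag-1 p a , swapTag-1 p' b , r)
  back (inj₂ (inj₂ (a , b , e))) = inj₂ (inj₂ (swapTag-2 p a , swapTag-2 p' b , e))

join-split : ∀ R R' a b → (R ⊕ R') a b ⇔ Split R R' (a % 2) (a / 2) (b % 2) (b / 2)
join-split R R' a b =
  mk⇔ (λ { (inj₁ s) → inj₁ s ; (inj₂ s) → inj₂ (inj₁ s) })
      (λ { (inj₁ s) → inj₁ s ; (inj₂ (inj₁ s)) → inj₂ s ; (inj₂ (inj₂ (e , _))) → ⊥-elim (%2≢2 a e) })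

tag : ℕ → ℕ → ℕ
tag zero o = o % 2
tag (suc k) o = ifz (o % 2) ((o / 2) % 2) 2

datum : ℕ → ℕ → ℕ
datum zero o = o / 2
datum (suc k) o = ifz (o % 2) ((o / 2) / 2) ((o / 2) % suc k)

tagT : ℕ → Tot 1
tagT k = reshape (program k) (λ { (o ∷ []) → tag k o }) (λ { (o ∷ []) → agree k o })
  where
  program : ℕ → Tot 1
  program zero = mod2T
  program (suc k) = ifZero mod2T (app₁ mod2T div2T) (constT 2)
  agree : ∀ k o → fun (program k) (o ∷ []) ≡ tag k o
  agree zero o = refl
  agree (suc k) o = refl

datumT : ℕ → Tot 1
datumT k = reshape (program k) (λ { (o ∷ []) → datum k o }) (λ { (o ∷ []) → agree k o })
  where
  program : ℕ → Tot 1
  program zero = div2T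
  program (suc k) = ifZero mod2T (app₁ div2T div2T) (app₁ (modT k) div2T)
  agree : ∀ k o → fun (program k) (o ∷ []) ≡ datum k o
  agree zero o = refl
  agree (suc k) o = refl

decode-⊕Id : ∀ (W : Rel) (Φ : Tagged) → TagTwoIsId Φ →
  (∀ a b → W a b ⇔ Φ (a % 2) (a / 2) (b % 2) (b / 2)) →
  ∀ k o o' → (W ⊕Id k) o o' ⇔ Φ (tag k o) (datum k o) (tag k o') (datum k o')
decode-⊕Id W Φ props byParity zero o o' = byParity o o'
decode-⊕Id W Φ (two-is-id , two-rightˡ , two-leftʳ) byParity (suc k) o o' = on (parity o) (parity o')
  where
  M : Rel
  M x y = x % suc k ≡ y % suc k
  tag-even : ∀ m → tag (suc k) (2 * m) ≡ m % 2
  tag-even m rewrite even%2 m | even/2 m = refl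
  datum-even : ∀ m → datum (suc k) (2 * m) ≡ m / 2
  datum-even m rewrite even%2 m | even/2 m = refl
  tag-odd : ∀ m → tag (suc k) (2 * m + 1) ≡ 2
  tag-odd m rewrite odd%2 m = refl
  datum-odd : ∀ m → datum (suc k) (2 * m + 1) ≡ m % suc k
  datum-odd m rewrite odd%2 m | odd/2 m = refl
  on : ∀ {o o'} → Parity o → Parity o' →
    (W ⊕Id suc k) o o' ⇔ Φ (tag (suc k) o) (datum (suc k) o) (tag (suc k) o') (datum (suc k) o')
  on (even m) (even n) rewrite tag-even m | datum-even m | tag-even n | datum-even n =
    ⇔-trans (⊕-even {W} {M} m n) (byParity m n)
  on (odd m) (odd n) rewrite tag-odd m | datum-odd m | tag-odd n | datum-odd n =
    ⇔-trans (⊕-odd {W} {M} m n) (⇔-sym (two-is-id _ _))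
  on (even m) (odd n) rewrite tag-even m | datum-even m | tag-odd n | datum-odd n =
    mk⇔ (⊥-elim ∘ ⊕-even-odd {W} {M} m n) (λ r → ⊥-elim (%2≢2 m (two-rightˡ _ _ _ r)))
  on (odd m) (even n) rewrite tag-odd m | datum-odd m | tag-even n | datum-even n =
    mk⇔ (⊥-elim ∘ ⊕-odd-even {W} {M} m n) (λ r → ⊥-elim (%2≢2 n (two-leftʳ _ _ _ r)))

module JoinCollapse {R₁ R₂ : Rel} (e₁ : IsEquivalence R₁) (e₂ : IsEquivalence R₂) (x₀ y₀ : ℕ) where
  S : Rel
  S = R₁ ⊕ R₂

  C : Rel
  C = Collapse S (2 * x₀) (2 * y₀ + 1)

  open CollapseNormalForm (join-isEquivalence e₁ e₂) (2 * x₀) (2 * y₀ + 1)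

  collapse-even : ∀ m n → C (2 * m) (2 * n) ⇔ R₁ m n
  collapse-even m n = ⇔-trans (collapse⇔NF _ _) (mk⇔ left (inj₁ ∘ from (⊕-even {R₁} {R₂} m n)))
    where
    left : NF (2 * m) (2 * n) → R₁ m n
    left (inj₁ s) = to (⊕-even {R₁} {R₂} m n) s
    left (inj₂ (inj₁ (_ , yb))) = ⊥-elim (⊕-odd-even {R₁} {R₂} y₀ n yb)
    left (inj₂ (inj₂ (ay , _))) = ⊥-elim (⊕-even-odd {R₁} {R₂} m y₀ ay)

  collapse-odd : ∀ m n → C (2 * m + 1) (2 * n + 1) ⇔ R₂ m n
  collapse-odd m n = ⇔-trans (collapse⇔NF _ _) (mk⇔ right (inj₁ ∘ from (⊕-odd {R₁} {R₂} m n)))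
    where
    right : NF (2 * m + 1) (2 * n + 1) → R₂ m n
    right (inj₁ s) = to (⊕-odd {R₁} {R₂} m n) s
    right (inj₂ (inj₁ (ax , _))) = ⊥-elim (⊕-odd-even {R₁} {R₂} m x₀ ax)
    right (inj₂ (inj₂ (_ , xb))) = ⊥-elim (⊕-even-odd {R₁} {R₂} x₀ n xb)

  Cross : Tagged
  Cross p d p' d' = (p ≡ 0 × p' ≡ 1 × R₁ d x₀ × R₂ y₀ d')
                  ⊎ (p ≡ 1 × p' ≡ 0 × R₂ d y₀ × R₁ x₀ d')

  SplitC : Tagged
  SplitC p d p' d' = Split R₁ R₂ p d p' d' ⊎ Cross p d p' d'

  splitC-tagTwoIsId : TagTwoIsId SplitC
  splitC-tagTwoIsId = two-is-id , two-right , two-left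
    where
    split : TagTwoIsId (Split R₁ R₂)
    split = split-tagTwoIsId R₁ R₂
    two-is-id : ∀ d d' → SplitC 2 d 2 d' ⇔ (d ≡ d')
    two-is-id d d' = mk⇔ (λ { (inj₁ s) → to (proj₁ split d d') s ; (inj₂ (inj₁ (() , _))) ; (inj₂ (inj₂ (() , _))) })
                         (λ e → inj₁ (from (proj₁ split d d') e))
    two-right : ∀ p d d' → SplitC p d 2 d' → p ≡ 2
    two-right p d d' (inj₁ s) = proj₁ (proj₂ split) p d d' s
    two-right p d d' (inj₂ (inj₁ (_ , () , _)))
    two-right p d d' (inj₂ (inj₂ (_ , () , _)))
    two-left : ∀ p d d' → SplitC 2 d p d' → p ≡ 2
    two-left p d d' (inj₁ s) = proj₂ (proj₂ split) p d d' s
    two-left p d d' (inj₂ (inj₁ (() , _)))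
    two-left p d d' (inj₂ (inj₂ (() , _)))

  collapse-split : ∀ a b → C a b ⇔ SplitC (a % 2) (a / 2) (b % 2) (b / 2)
  collapse-split a b = ⇔-trans (collapse⇔NF a b) (mk⇔ there back)
    where
    at-x : S a (2 * x₀) ⇔ (a % 2 ≡ 0 × R₁ (a / 2) x₀)
    at-x = ⊕-to-even {R₁} {R₂} a x₀
    at-y : S a (2 * y₀ + 1) ⇔ (a % 2 ≡ 1 × R₂ (a / 2) y₀)
    at-y = ⊕-to-odd {R₁} {R₂} a y₀
    from-x : S (2 * x₀) b ⇔ (b % 2 ≡ 0 × R₁ x₀ (b / 2))
    from-x = ⊕-from-even {R₁} {R₂} x₀ b
    from-y : S (2 * y₀ + 1) b ⇔ (b % 2 ≡ 1 × R₂ y₀ (b / 2))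
    from-y = ⊕-from-odd {R₁} {R₂} y₀ b
    there : NF a b → SplitC (a % 2) (a / 2) (b % 2) (b / 2)
    there (inj₁ s) = inj₁ (to (join-split R₁ R₂ a b) s)
    there (inj₂ (inj₁ (ax , yb))) = let (p , r) = to at-x ax ; (p' , r') = to from-y yb in inj₂ (inj₁ (p , p' , r , r'))
    there (inj₂ (inj₂ (ay , xb))) = let (p , r) = to at-y ay ; (p' , r') = to from-x xb in inj₂ (inj₂ (p , p' , r , r'))
    back : SplitC (a % 2) (a / 2) (b % 2) (b / 2) → NF a b
    back (inj₁ s) = inj₁ (from (join-split R₁ R₂ a b) s)
    back (inj₂ (inj₁ (p , p' , r , r'))) = inj₂ (inj₁ (from at-x (p , r) , from from-y (p' , r')))
    back (inj₂ (inj₂ (p , p' , r , r'))) = inj₂ (inj₂ (from at-y (p , r) , from from-x (p' , r')))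

-- Double negation.  Case distinctions that cannot be made constructively
-- are made under ¬¬, which suffices because all our goals are negations.

¬¬_ : Set → Set
¬¬ A = ¬ ¬ A

infix 3 ¬¬_

_>>=_ : ∀ {A B : Set} → ¬¬ A → (A → ¬¬ B) → ¬¬ B
(a >>= f) k = a (λ x → f x k)

return : ∀ {A : Set} → A → ¬¬ A
return x k = k x

excluded-middle : ∀ (P : Set) → ¬¬ Dec P
excluded-middle P k = k (no (λ p → k (yes p)))

decide-all : ∀ n (P : Fin n → Set) → ¬¬ (∀ i → Dec (P i))
decide-all zero P = return (λ ())
decide-all (suc n) P = excluded-middle (P zero) >>= λ d → decide-all n (λ i → P (suc i)) >>= λ ds →
  return (λ { zero → d ; (suc i) → ds i })

-- If every point of the
-- image of a computable g is R-equivalent to one of b 0, …, b (n-1), then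
-- { z | R w (g z) } is computable once we know which b i are R-equivalent
-- to w: both it and its complement are semi-decidable.

finite-class-computable : ∀ {R : Rel} → IsCeer R → ∀ n (b : Fin n → ℕ) (G : Tot 1) →
  (∀ z → ∃ λ i → R (fun G (z ∷ [])) (b i)) → ∀ w → (∀ i → Dec (R w (b i))) →
  Σ (Tot 1) λ χ → ∀ z → R w (fun G (z ∷ [])) ⇔ (fun χ (z ∷ []) ≡ 0)
finite-class-computable {R} ((record { sym = R-sym ; trans = R-trans }) , ce) n b G cover w table =
  let (χ , decides) = post inClass outClass covered disjoint in χ , λ z → decides (z ∷ [])
  where
  In : Vec ℕ 1 → Set
  In xs = R (fun (constT w) xs) (fun G xs)
  Out : Vec ℕ 1 → Set
  Out xs = Σ (Fin n) λ i → ¬ R w (b i) × R (fun G xs) (fun (constT (b i)) xs)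
  inClass : SemiDec In
  inClass = semi-rel ce (constT w) G
  outClass : SemiDec Out
  outClass = semi-∃Fin n _ witness
    where
    witness : ∀ i → SemiDec (λ xs → ¬ R w (b i) × R (fun G xs) (fun (constT (b i)) xs))
    witness i with table i
    ... | yes r = semi-⇔ (λ xs → mk⇔ ⊥-elim (λ { (nr , _) → nr r })) semi-⊥
    ... | no nr = semi-⇔ (λ xs → mk⇔ (nr ,_) proj₂) (semi-rel ce G (constT (b i)))
  covered : ∀ xs → In xs ⊎ Out xs
  covered (z ∷ []) with cover z
  ... | i , r with table i
  ...   | yes r' = inj₁ (R-trans r' (R-sym r))
  ...   | no nr = inj₂ (i , nr , r)
  disjoint : ∀ xs → In xs → Out xs → ⊥
  disjoint xs p (i , nr , r) = nr (R-trans p r)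

-- The splitting lemma

-- every X ≤c R is finite or above R; shared by dark minimal and ℤ-dark minimal ceers
Minimal : Rel → Set₁
Minimal R = ∀ (X : Rel) → IsCeer X → X ≤c R → Finite X ⊎ (R ≤I X)

module Splitting (R R' : Rel) (ceR : IsCeer R) (minR : Minimal R) (R≰R' : ¬ (R ≤I R'))
  (π δ : ℕ → ℕ) (cπ : Computable π) (cδ : Computable δ)
  (spec : ∀ u v → R u v ⇔ Split R R' (π u) (δ u) (π v) (δ v)) where

  open IsEquivalence (proj₁ ceR) renaming (refl to R-refl; sym to R-sym; trans to R-trans)

  Π Δ : Tot 1
  Π = toTot cπ
  Δ = toTot cδ

  same-tag : ∀ {u v} → R u v → π u ≡ π v
  same-tag r with to (spec _ _) r
  ... | inj₁ (p , q , _) = trans p (sym q)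
  ... | inj₂ (inj₁ (p , q , _)) = trans p (sym q)
  ... | inj₂ (inj₂ (p , q , _)) = trans p (sym q)

  tag0-forth : ∀ {u v} → R u v → π u ≡ 0 → R (δ u) (δ v)
  tag0-forth r p with to (spec _ _) r
  ... | inj₁ (_ , _ , r') = r'
  ... | inj₂ (inj₁ (q , _ , _)) = ⊥-elim (0≢1 (trans (sym p) q))
  ... | inj₂ (inj₂ (q , _ , _)) = ⊥-elim (0≢2 (trans (sym p) q))

  tag0-back : ∀ {u v} → π u ≡ 0 → π v ≡ 0 → R (δ u) (δ v) → R u v
  tag0-back p q r = from (spec _ _) (inj₁ (p , q , r))

  -- A class of tag 1: R restricted to tag 1 reduces to R', so it is not
  -- above R, hence finite, and its classes are computable.
  tag1-class : ∀ w → π w ≡ 1 → ¬¬ ComputableSet (R w)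
  tag1-class w πw≡1 = finite-or-above (minR X (pullback-isCeer ceR G) X≤R)
    where
    G : Tot 1
    G = ifZero (app₂ neqT Π (constT 1)) #0 (constT w)
    g : ℕ → ℕ
    g z = fun G (z ∷ [])
    g-tag : ∀ z → π (g z) ≡ 1
    g-tag z with neq (π z) 1 in eq
    ... | zero = neq-sound _ _ eq
    ... | suc _ = πw≡1
    g-fixes : ∀ z → π z ≡ 1 → g z ≡ z
    g-fixes z p rewrite p = refl
    X : Rel
    X a b = R (g a) (g b)
    X≤R : X ≤c R
    X≤R = g , tot-computable G , λ a b → ⇔-refl
    X≤R' : X ≤c R'
    X≤R' = (λ a → δ (g a)) , computable-∘ (tot-computable G) cδ ,
      λ a b → ⇔-trans (spec _ _) (mk⇔ (tag1 a b) (λ r → inj₂ (inj₁ (g-tag a , g-tag b , r))))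
      where
      tag1 : ∀ a b → Split R R' (π (g a)) (δ (g a)) (π (g b)) (δ (g b)) → R' (δ (g a)) (δ (g b))
      tag1 a b (inj₁ (p , _ , _)) = ⊥-elim (0≢1 (trans (sym p) (g-tag a)))
      tag1 a b (inj₂ (inj₁ (_ , _ , r))) = r
      tag1 a b (inj₂ (inj₂ (p , _ , _))) = ⊥-elim (1≢2 (trans (sym (g-tag a)) p))
    class : (χ : Tot 1) → (∀ z → R w (g z) ⇔ (fun χ (z ∷ []) ≡ 0)) →
      ∀ z → R w z ⇔ ((π z ≡ 1) × (fun χ (z ∷ []) ≡ 0))
    class χ decides z = mk⇔
      (λ r → let p = trans (sym (same-tag r)) πw≡1 in p , to (decides z) (subst (R w) (sym (g-fixes z p)) r))
      (λ { (p , e) → subst (R w) (g-fixes z p) (from (decides z) e) })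
    finite-or-above : Finite X ⊎ (R ≤I X) → ¬¬ ComputableSet (R w)
    finite-or-above (inj₂ R≤X) = λ _ → R≰R' (≤I-≤c-trans R≤X X≤R')
    finite-or-above (inj₁ (n , a , cover)) = decide-all n (λ i → R w (g (a i))) >>= λ table →
      let (χ , decides) = finite-class-computable ceR n (λ i → g (a i)) G cover w table
          (χ' , decides') = guarded Π χ 1
      in return (decidedSet χ' λ z → ⇔-trans (class χ decides z) (decides' z))

  -- a class of tag 2 is a single fibre of δ inside tag 2
  tag2-class : ∀ w → π w ≡ 2 → ComputableSet (R w)
  tag2-class w πw≡2 = let (χ , decides) = guarded Π (app₂ neqT Δ (constT (δ w))) 2 in
                      decidedSet χ λ z → ⇔-trans (class z) (decides z)
    where
    class : ∀ z → R w z ⇔ ((π z ≡ 2) × (neq (δ z) (δ w) ≡ 0))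
    class z = mk⇔ fibre (λ { (p , e) → from (spec _ _) (inj₂ (inj₂ (πw≡2 , p , sym (neq-sound _ _ e)))) })
      where
      fibre : R w z → (π z ≡ 2) × (neq (δ z) (δ w) ≡ 0)
      fibre r with to (spec _ _) r
      ... | inj₁ (p , _ , _) = ⊥-elim (0≢2 (trans (sym p) πw≡2))
      ... | inj₂ (inj₁ (p , _ , _)) = ⊥-elim (1≢2 (trans (sym p) πw≡2))
      ... | inj₂ (inj₂ (_ , q , e)) rewrite e = q , neq-refl (δ z)

  nonzero-tag-class : ∀ w → π w ≢ 0 → ¬¬ ComputableSet (R w)
  nonzero-tag-class w π≢0 with to (spec w w) R-refl
  ... | inj₁ (p , _ , _) = ⊥-elim (π≢0 p)
  ... | inj₂ (inj₁ (p , _ , _)) = tag1-class w p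
  ... | inj₂ (inj₂ (p , _ , _)) = return (tag2-class w p)

  noncomputable-tag0 : ∀ x₀ → ¬ ComputableSet (R x₀) → π x₀ ≡ 0
  noncomputable-tag0 x₀ nc with π x₀ ≟ 0
  ... | yes p = p
  ... | no π≢0 = ⊥-elim (nonzero-tag-class x₀ π≢0 nc)

  δ^ : ℕ → ℕ → ℕ
  δ^ zero u = u
  δ^ (suc t) u = δ (δ^ t u)

  δ^T : ℕ → Tot 1
  δ^T t = reshape (program t) (λ { (u ∷ []) → δ^ t u }) (λ { (u ∷ []) → agree t u })
    where
    program : ℕ → Tot 1
    program zero = #0
    program (suc t) = app₁ Δ (program t)
    agree : ∀ t u → fun (program t) (u ∷ []) ≡ δ^ t u
    agree zero u = refl
    agree (suc t) u = cong δ (agree t u)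

  stays : ℕ → ℕ → ℕ
  stays zero u = 0
  stays (suc t) u = ifz (stays t u) (neq (π (δ^ t u)) 0) 1

  staysT : ℕ → Tot 1
  staysT t = reshape (program t) (λ { (u ∷ []) → stays t u }) (λ { (u ∷ []) → agree t u })
    where
    program : ℕ → Tot 1
    program zero = zeroT
    program (suc t) = ifZero (program t) (app₂ neqT (app₁ Π (δ^T t)) zeroT) (constT 1)
    agree : ∀ t u → fun (program t) (u ∷ []) ≡ stays t u
    agree zero u = refl
    agree (suc t) u = cong (λ A → ifz A (neq (π (δ^ t u)) 0) 1) (agree t u)

  stays-spec : ∀ t u → (stays t u ≡ 0) ⇔ (∀ i → i < t → π (δ^ i u) ≡ 0)
  stays-spec zero u = mk⇔ (λ _ i ()) (λ _ → refl)
  stays-spec (suc t) u = mk⇔ forth back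
    where
    forth : stays (suc t) u ≡ 0 → ∀ i → i < suc t → π (δ^ i u) ≡ 0
    forth e i i<1+t with stays t u in eq
    ... | zero with m≤n⇒m<n∨m≡n (≤-pred i<1+t)
    ...   | inj₁ i<t = to (stays-spec t u) eq i i<t
    ...   | inj₂ refl = neq-sound _ _ e
    forth () i i<1+t | suc _
    back : (∀ i → i < suc t → π (δ^ i u) ≡ 0) → stays (suc t) u ≡ 0
    back h rewrite from (stays-spec t u) (λ i i<t → h i (m≤n⇒m≤1+n i<t)) | h t ≤-refl = refl

  -- Second consequence: if R is not light, a non-computable class [x₀]
  -- receives some tag-0 point under δ.  Otherwise follow x₀ under δ.
  module Orbit (x₀ : ℕ) (x₀-noncomputable : ¬ ComputableSet (R x₀)) (not-light : ¬ Light R)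
               (no-return : ∀ u → π u ≡ 0 → ¬ R (δ u) x₀) where

    orbitT : Tot 1
    orbitT = reshape (recT (constT x₀) (app₁ Δ #1)) (λ { (n ∷ []) → δ^ n x₀ }) (λ { (n ∷ []) → agree n })
      where
      agree : ∀ n → iterate (constT x₀) (app₁ Δ #1) n [] ≡ δ^ n x₀
      agree zero = refl
      agree (suc n) = cong δ (agree n)

    -- An orbit that never leaves tag 0 never returns to a class it visited,
    -- so it reduces Id to R.
    stays-forever : (∀ t → π (δ^ t x₀) ≡ 0) → ⊥
    stays-forever tag0 =
      not-light ((λ n → δ^ n x₀) , tot-computable orbitT , λ n m → mk⇔ (λ { refl → R-refl }) injective)
      where
      no-loop : ∀ j d → R (δ^ j x₀) (δ^ (j + suc d) x₀) → ⊥
      no-loop zero d r = no-return (δ^ d x₀) (tag0 d) (R-sym r)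
      no-loop (suc j) d r = no-loop j d (tag0-back (tag0 j) (tag0 (j + suc d)) r)
      gap : ∀ {n m} → n < m → Σ ℕ λ d → m ≡ n + suc d
      gap {zero} {suc m} _ = m , refl
      gap {suc n} {suc m} (s≤s n<m) = let (d , e) = gap n<m in d , cong suc e
      injective : ∀ {n m} → R (δ^ n x₀) (δ^ m x₀) → n ≡ m
      injective {n} {m} r with <-cmp n m
      ... | tri≈ _ e _ = e
      ... | tri< n<m _ _ = let (d , e) = gap n<m in
                           ⊥-elim (no-loop n d (subst (λ q → R (δ^ n x₀) (δ^ q x₀)) e r))
      ... | tri> _ _ m<n = let (d , e) = gap m<n in
                           ⊥-elim (no-loop m d (subst (λ q → R (δ^ m x₀) (δ^ q x₀)) e (R-sym r)))

    -- If the orbit first leaves tag 0 at step t, then u ∈ [x₀] iff δⁱu has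
    -- tag 0 for i < t and δᵗu ∈ [δᵗx₀]; the latter class is computable.
    exits : ∀ t → π (δ^ t x₀) ≢ 0 → (∀ i → i < t → π (δ^ i x₀) ≡ 0) → ⊥
    exits t π≢0 before = nonzero-tag-class (δ^ t x₀) π≢0 transfer
      where
      forth : ∀ {u} → R x₀ u → ∀ i → i ≤ t → R (δ^ i x₀) (δ^ i u)
      forth r zero _ = r
      forth r (suc i) i<t = tag0-forth (forth r i (<⇒≤ i<t)) (before i i<t)
      back : ∀ {u} → (∀ i → i < t → π (δ^ i u) ≡ 0) → ∀ i → i ≤ t → R (δ^ i x₀) (δ^ i u) → R x₀ u
      back tag0 zero _ r = r
      back tag0 (suc i) i<t r = back tag0 i (<⇒≤ i<t) (tag0-back (before i i<t) (tag0 i i<t) r)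
      class : ∀ χ → (∀ z → R (δ^ t x₀) z ⇔ (χ z ≡ 0)) →
        ∀ u → R x₀ u ⇔ ((stays t u ≡ 0) × (χ (δ^ t u) ≡ 0))
      class χ decides u = mk⇔
        (λ r → from (stays-spec t u) (λ i i<t → trans (sym (same-tag (forth r i (<⇒≤ i<t)))) (before i i<t)) ,
               to (decides _) (forth r t ≤-refl))
        (λ { (s , e) → back (to (stays-spec t u) s) t ≤-refl (from (decides _) e) })
      transfer : ¬ ComputableSet (R (δ^ t x₀))
      transfer (χ , cχ , decides) =
        let (χ' , decides') = guarded (staysT t) (app₁ (toTot cχ) (δ^T t)) 0 in
        x₀-noncomputable (decidedSet χ' λ u → ⇔-trans (class χ decides u) (decides' u))

    first-exit : ∀ t → (Σ ℕ λ j → j < t × π (δ^ j x₀) ≢ 0 × (∀ i → i < j → π (δ^ i x₀) ≡ 0))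
                       ⊎ (∀ j → j < t → π (δ^ j x₀) ≡ 0)
    first-exit zero = inj₂ (λ j ())
    first-exit (suc t) with first-exit t
    ... | inj₁ (j , j<t , exit , before) = inj₁ (j , m≤n⇒m≤1+n j<t , exit , before)
    ... | inj₂ before with π (δ^ t x₀) ≟ 0
    ...   | no exit = inj₁ (t , ≤-refl , exit , before)
    ...   | yes tag0 = inj₂ upTo
      where
      upTo : ∀ j → j < suc t → π (δ^ j x₀) ≡ 0
      upTo j j<1+t with m≤n⇒m<n∨m≡n (≤-pred j<1+t)
      ... | inj₁ j<t = before j j<t
      ... | inj₂ refl = tag0

    contradiction : ⊥
    contradiction = stays-forever tag0
      where
      tag0 : ∀ t → π (δ^ t x₀) ≡ 0
      tag0 t with first-exit (suc t)
      ... | inj₁ (j , _ , exit , before) = ⊥-elim (exits j exit before)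
      ... | inj₂ upTo = upTo t ≤-refl

minimal : ∀ {R} → DarkMinimal R ⊎ ZDarkMinimal R → Minimal R
minimal (inj₁ (_ , _ , dark-minimal)) X ceX X≤R with dark-minimal X ceX X≤R
... | inj₁ finite = inj₁ finite
... | inj₂ (_ , R≤X) = inj₂ (0 , R≤X)
minimal (inj₂ (_ , _ , minimal-degree , _)) X ceX X≤R = minimal-degree X ceX (0 , X≤R)

not-light : ∀ {R} → DarkMinimal R ⊎ ZDarkMinimal R → ¬ Light R
not-light (inj₁ (_ , dark , _)) = proj₂ dark
not-light (inj₂ (_ , dark , _)) = proj₂ dark

oddT : Tot 1
oddT = reshape (app₁ sucT doubleT) (λ { (x ∷ []) → 2 * x + 1 }) (λ { (x ∷ []) → suc-even x })

swapTagT : Tot 1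
swapTagT = reshape (ifZero #0 (constT 1) (ifZero (app₁ predT #0) zeroT #0))
                   (λ { (p ∷ []) → swapTag p })
                   (λ { (zero ∷ []) → refl ; (suc zero ∷ []) → refl ; (suc (suc p) ∷ []) → refl })

module Incomparability (R₁ R₂ : Rel) (ce₁ : IsCeer R₁) (ce₂ : IsCeer R₂)
  (m₁ : DarkMinimal R₁ ⊎ ZDarkMinimal R₁) (m₂ : DarkMinimal R₂ ⊎ ZDarkMinimal R₂)
  (R₁≰R₂ : ¬ (R₁ ≤I R₂)) (R₂≰R₁ : ¬ (R₂ ≤I R₁))
  (x₀ y₀ : ℕ) (nc₁ : ¬ ComputableSet (R₁ x₀)) (nc₂ : ¬ ComputableSet (R₂ y₀)) where

  open JoinCollapse (proj₁ ce₁) (proj₁ ce₂) x₀ y₀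
  open IsEquivalence (proj₁ ce₁) using () renaming (sym to R₁-sym)
  open IsEquivalence (proj₁ ce₂) using () renaming (sym to R₂-sym)

  -- tags and data of the images of the even and the odd half under f;
  -- on the odd half tags 0 and 1 are exchanged so that R₂ plays the role of R
  module Halves (k : ℕ) (f : ℕ → ℕ) (cf : Computable f) where
    F : Tot 1
    F = toTot cf

    π₁ δ₁ tag₂ π₂ δ₂ : ℕ → ℕ
    π₁ u = tag k (f (2 * u))
    δ₁ u = datum k (f (2 * u))
    tag₂ v = tag k (f (2 * v + 1))
    π₂ v = swapTag (tag₂ v)
    δ₂ v = datum k (f (2 * v + 1))

    cπ₁ : Computable π₁
    cπ₁ = tot-computable (app₁ (tagT k) (app₁ F doubleT))
    cδ₁ : Computable δ₁
    cδ₁ = tot-computable (app₁ (datumT k) (app₁ F doubleT))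
    cπ₂ : Computable π₂
    cπ₂ = tot-computable (app₁ swapTagT (app₁ (tagT k) (app₁ F oddT)))
    cδ₂ : Computable δ₂
    cδ₂ = tot-computable (app₁ (datumT k) (app₁ F oddT))

  -- C ≰I S: the halves of a reduction split R₁ and R₂, so both
  -- non-computable classes get tag 0 on their own side, i.e. the C-equal
  -- points 2x₀ and 2y₀+1 are sent to different tags.
  collapse≰join : ¬ (C ≤I S)
  collapse≰join (k , f , cf , reduces) =
    different-tags (to (decode (f (2 * x₀)) (f (2 * y₀ + 1))) (to (reduces _ _) pair))
    where
    open Halves k f cf
    decode : ∀ o o' → (S ⊕Id k) o o' ⇔ Split R₁ R₂ (tag k o) (datum k o) (tag k o') (datum k o')
    decode = decode-⊕Id S (Split R₁ R₂) (split-tagTwoIsId R₁ R₂) (join-split R₁ R₂) k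
    split₁ : ∀ u v → R₁ u v ⇔ Split R₁ R₂ (π₁ u) (δ₁ u) (π₁ v) (δ₁ v)
    split₁ u v = ⇔-trans (⇔-sym (collapse-even u v)) (⇔-trans (reduces _ _) (decode _ _))
    split₂ : ∀ u v → R₂ u v ⇔ Split R₂ R₁ (π₂ u) (δ₂ u) (π₂ v) (δ₂ v)
    split₂ u v = ⇔-trans (⇔-sym (collapse-odd u v))
                         (⇔-trans (reduces _ _) (⇔-trans (decode _ _) (split-swap R₁ R₂ _ _ _ _)))
    x-tag : π₁ x₀ ≡ 0
    x-tag = Splitting.noncomputable-tag0 R₁ R₂ ce₁ (minimal m₁) R₁≰R₂ π₁ δ₁ cπ₁ cδ₁ split₁ x₀ nc₁
    y-tag : tag₂ y₀ ≡ 1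
    y-tag = swapTag-0 _
      (Splitting.noncomputable-tag0 R₂ R₁ ce₂ (minimal m₂) R₂≰R₁ π₂ δ₂ cπ₂ cδ₂ split₂ y₀ nc₂)
    different-tags : ¬ Split R₁ R₂ (π₁ x₀) (δ₁ x₀) (tag₂ y₀) (δ₂ y₀)
    different-tags (inj₁ (_ , p , _)) = 0≢1 (trans (sym p) y-tag)
    different-tags (inj₂ (inj₁ (p , _ , _))) = 0≢1 (trans (sym x-tag) p)
    different-tags (inj₂ (inj₂ (p , _ , _))) = 0≢2 (trans (sym x-tag) p)

  -- S ≰I C: the new pairs of C cannot be used from both halves, since that
  -- would make an even and an odd point S-equal.  The half that does not
  -- use them is split with no return into its non-computable class.
  join≰collapse : ¬ (S ≤I C)
  join≰collapse (k , f , cf , reduces) =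
    one-half-avoids λ { (inj₁ avoid₁) → no-return₁ avoid₁ ; (inj₂ avoid₂) → no-return₂ avoid₂ }
    where
    open Halves k f cf
    decode : ∀ o o' → (C ⊕Id k) o o' ⇔ SplitC (tag k o) (datum k o) (tag k o') (datum k o')
    decode = decode-⊕Id C SplitC splitC-tagTwoIsId collapse-split k
    Returns₁ Returns₂ : Set
    Returns₁ = Σ ℕ λ u → π₁ u ≡ 0 × R₁ (δ₁ u) x₀
    Returns₂ = Σ ℕ λ v → tag₂ v ≡ 1 × R₂ (δ₂ v) y₀
    not-both : Returns₁ → Returns₂ → ⊥
    not-both (u , p , r) (v , q , r') =
      ⊕-even-odd {R₁} {R₂} u v (from (reduces _ _) (from (decode _ _) (inj₂ (inj₁ (p , q , r , R₂-sym r')))))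
    one-half-avoids : ¬¬ (¬ Returns₁ ⊎ ¬ Returns₂)
    one-half-avoids refute = refute (inj₁ (λ ret₁ → refute (inj₂ (λ ret₂ → not-both ret₁ ret₂))))
    no-return₁ : ¬ Returns₁ → ⊥
    no-return₁ avoid = Splitting.Orbit.contradiction R₁ R₂ ce₁ (minimal m₁) R₁≰R₂ π₁ δ₁ cπ₁ cδ₁ split₁
                         x₀ nc₁ (not-light m₁) (λ u p r → avoid (u , p , r))
      where
      no-cross : ∀ u v → SplitC (π₁ u) (δ₁ u) (π₁ v) (δ₁ v) →
        Split R₁ R₂ (π₁ u) (δ₁ u) (π₁ v) (δ₁ v)
      no-cross u v (inj₁ s) = s
      no-cross u v (inj₂ (inj₁ (p , _ , r , _))) = ⊥-elim (avoid (u , p , r))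
      no-cross u v (inj₂ (inj₂ (_ , q , _ , r))) = ⊥-elim (avoid (v , q , R₁-sym r))
      split₁ : ∀ u v → R₁ u v ⇔ Split R₁ R₂ (π₁ u) (δ₁ u) (π₁ v) (δ₁ v)
      split₁ u v = ⇔-trans (⇔-sym (⊕-even {R₁} {R₂} u v))
                           (⇔-trans (reduces _ _) (⇔-trans (decode _ _) (mk⇔ (no-cross u v) inj₁)))
    no-return₂ : ¬ Returns₂ → ⊥
    no-return₂ avoid = Splitting.Orbit.contradiction R₂ R₁ ce₂ (minimal m₂) R₂≰R₁ π₂ δ₂ cπ₂ cδ₂ split₂
                         y₀ nc₂ (not-light m₂) (λ v p r → avoid (v , swapTag-0 _ p , r))
      where
      no-cross : ∀ v v' → SplitC (tag₂ v) (δ₂ v) (tag₂ v') (δ₂ v') →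
        Split R₁ R₂ (tag₂ v) (δ₂ v) (tag₂ v') (δ₂ v')
      no-cross v v' (inj₁ s) = s
      no-cross v v' (inj₂ (inj₁ (_ , q , _ , r))) = ⊥-elim (avoid (v' , q , R₂-sym r))
      no-cross v v' (inj₂ (inj₂ (p , _ , r , _))) = ⊥-elim (avoid (v , p , r))
      split₂ : ∀ v v' → R₂ v v' ⇔ Split R₂ R₁ (π₂ v) (δ₂ v) (π₂ v') (δ₂ v')
      split₂ v v' = ⇔-trans (⇔-sym (⊕-odd {R₁} {R₂} v v'))
                      (⇔-trans (reduces _ _)
                      (⇔-trans (decode _ _)
                      (⇔-trans (mk⇔ (no-cross v v') inj₁) (split-swap R₁ R₂ _ _ _ _))))

lemma3p11 : (R₁ R₂ : Rel) → IsCeer R₁ → IsCeer R₂ →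
    IncomparableI R₁ R₂ →
    (DarkMinimal R₁ ⊎ ZDarkMinimal R₁) →
    (DarkMinimal R₂ ⊎ ZDarkMinimal R₂) →
    (x₀ y₀ : ℕ) →
    ¬ ComputableSet (R₁ x₀) → ¬ ComputableSet (R₂ y₀) →
    IsCeer (R₁ ⊕ R₂) × IsCeer (Collapse (R₁ ⊕ R₂) (2 * x₀) (2 * y₀ + 1)) ×
    IncomparableI (R₁ ⊕ R₂) (Collapse (R₁ ⊕ R₂) (2 * x₀) (2 * y₀ + 1))
lemma3p11 R₁ R₂ ce₁ ce₂ (R₁≰R₂ , R₂≰R₁) m₁ m₂ x₀ y₀ nc₁ nc₂ =
  join-ce , collapse-isCeer join-ce (2 * x₀) (2 * y₀ + 1) , join≰collapse , collapse≰join
  where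
  join-ce : IsCeer (R₁ ⊕ R₂)
  join-ce = join-isCeer ce₁ ce₂
  open Incomparability R₁ R₂ ce₁ ce₂ m₁ m₂ R₁≰R₂ R₂≰R₁ x₀ y₀ nc₁ nc₂
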